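{- Let $X$ be a finite set with $|X|\ge 2$ and let $(\mathcal N,w)$ be a reticulation-pair weighted normal network on $X\cup\{r\}$, where $r\notin X$ is an outgroup. Let $\mathcal D_{\min}$ and $\mathbf d_{\max}$ be its minimum distance matrix and maximum distance outgroup vector. For $x,y\in X$ let $\mathcal Q_r(x,y)=\tfrac12\{d_{\max}(r,x)+d_{\max}(r,y)-d_{\min}(x,y)\}$, and let $\{s,t\}$ be a 2-element subset of $X$ with $\mathcal Q_r(s,t)=\max\{\mathcal Q_r(x,y): x,y\in X, x\neq y\}$. If $\{s,t\}$ is a cherry, then the matrix and vector obtained from $\mathcal D_{\min}$ and $\mathbf d_{\max}$ by reducing $t$ are the minimum distance matrix and maximum distance outgroup vector of the weighted network obtained from $(\mathcal N,w)$ by reducing $t$. If $\{s,t\}$ is a reticulated cherry in which $t$ is the reticulation leaf, then the matrix and vector obtained from $\mathcal D_{\min}$ and $\mathbf d_{\max}$ by isolating $\{s,t\}$ are the minimum distance matrix and maximum distance outgroup vector of the weighted network obtained from $(\mathcal N,w)$ by isolating $\{s,t\}$.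
   Context: A phylogenetic network on a non-empty finite set $Y$ is a rooted acyclic directed graph without parallel edges whose root has out-degree two, whose vertices of out-degree zero (leaves) are exactly the elements of $Y$ and have in-degree one, and all of whose other vertices are tree vertices (in-degree one, out-degree two) or reticulations (in-degree two, out-degree one). Edges into reticulations are reticulation edges, others tree edges. An edge $(u,v)$ is a shortcut if some directed path from $u$ to $v$ avoids it. The network is tree-child if every non-leaf vertex is the parent of a tree vertex or leaf, and normal if tree-child with no shortcuts. A leaf is an outgroup if its parent is the root. A weighting assigns non-negative reals to edges, strictly positive on tree edges; it is reticulation-pair if the two edges into each reticulation have equal weight. An up-down path between vertices $v,v'$ is an underlying path $v=u_0,\ldots,u_k=v'$ such that for some $i$, $(u_i,u_{i-1}),\ldots,(u_1,u_0)$ and $(u_i,u_{i+1}),\ldots,(u_{k-1},u_k)$ are edges; its length is the sum of its edge weights. For a network on $X\cup\{r\}$ with outgroup $r$: $d_{\min}(x,y)$ ($x,y\in X$) is the minimum length of an up-down path joining $x,y$, forming the $|X|\times|X|$ minimum distance matrix $\mathcal D_{\min}$; $d_{\max}(r,x)$ ($x\in X$) is the maximum length of an up-down path joining $r$ and $x$, forming the maximum distance outgroup vector $\mathbf d_{\max}$. With $p_s,p_t$ the parents of $s,t$: $\{s,t\}$ is a cherry if $p_s=p_t$, and a reticulated cherry with reticulation leaf $t$ if $p_t$ is a reticulation and $p_s$ is a parent of $p_t$. Network operations: for a cherry, with $g_s$ the parent of $p_s$, reducing $t$ deletes $t$ and its edge, suppresses $p_s$, and weights the new edge $(g_s,s)$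 by $w(g_s,p_s)+w(p_s,s)$. For a reticulated cherry with reticulation leaf $t$, let $g_t$ be the parent of $p_t$ other than $p_s$; if $g_t$ is a tree vertex with parent $g_t'$ and other child $h\neq p_t$, isolating $\{s,t\}$ deletes $(g_t,p_t)$, suppresses $g_t$ and $p_t$, and weights the new edges $(p_s,t)$ by $w(p_s,p_t)+w(p_t,t)$ and $(g_t',h)$ by $w(g_t',g_t)+w(g_t,h)$; other weights unchanged. Data operations: reducing $t$ in $(\mathcal D_{\min},\mathbf d_{\max})$ deletes the row and column of $t$ and the $t$-coordinate, leaving all other entries. Isolating $\{s,t\}$ in $(\mathcal D_{\min},\mathbf d_{\max})$: with $\gamma=d_{\max}(r,t)-d_{\max}(r,s)$, the new matrix $\mathcal D'$ on $X$ has $d'(x,y)=d_{\min}(x,y)$ for $x,y\in X-\{t\}$, $d'(t,t)=0$, $d'(t,x)=d'(x,t)=d_{\min}(s,x)+\gamma$ for $x\in X-\{s,t\}$, and $d'(s,t)=d'(t,s)=d_{\min}(s,t)$; the new vector equals $\mathbf d_{\max}$ (in particular its $t$-coordinate is $d_{\max}(r,s)+\gamma=d_{\max}(r,t)$). -}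

module Defs where

open import Level using (0ℓ) renaming (suc to lsuc)
open import Data.Bool using (Bool; true; false; T; _∧_; _∨_; not; if_then_else_)
open import Data.Nat using (ℕ; zero; suc; _<ᵇ_)
open import Data.Fin using (Fin; zero; suc; toℕ; inject₁; _≟_)
open import Data.List using (List; length; filterᵇ; allFin)
open import Data.Product using (Σ; ∃; _×_; _,_)
open import Data.Sum using (_⊎_)
open import Relation.Nullary using (¬_; ⌊_⌋)
open import Relation.Binary.PropositionalEquality using (_≡_; _≢_)
open import Relation.Binary.Structures using (IsTotalOrder)
open import Algebra.Structures using (IsCommutativeRing)
open import Function.Definitions using (Injective)

-- The real numbers, axiomatised as a Dedekind-complete ordered field
-- (unique up to isomorphism). Theorems quantify over every such model.

record RealField : Set₁ where
  infixl 6 _+_ _-_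
  infixl 7 _*_
  infix  4 _≤_ _<_
  field
    Carrier : Set
    _+_ _*_ : Carrier → Carrier → Carrier
    -_      : Carrier → Carrier
    0# 1#   : Carrier
    _≤_     : Carrier → Carrier → Set
    isCommutativeRing : IsCommutativeRing _≡_ _+_ _*_ -_ 0# 1#
    isTotalOrder      : IsTotalOrder _≡_ _≤_
    0≢1     : 0# ≢ 1#
    inverse : ∀ x → x ≢ 0# → Σ Carrier (λ y → x * y ≡ 1#)
    +-monoˡ-≤ : ∀ {x y} z → x ≤ y → x + z ≤ y + z
    *-nonneg  : ∀ {x y} → 0# ≤ x → 0# ≤ y → 0# ≤ x * y
    complete  : (P : Carrier → Set) → Σ Carrier P →
                Σ Carrier (λ b → ∀ x → P x → x ≤ b) →
                Σ Carrier (λ s → (∀ x → P x → x ≤ s) ×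
                                 (∀ b → (∀ x → P x → x ≤ b) → s ≤ b))

  _-_ : Carrier → Carrier → Carrier
  x - y = x + (- y)

  _<_ : Carrier → Carrier → Set
  x < y = (x ≤ y) × (x ≢ y)

_==_ : ∀ {n} → Fin n → Fin n → Bool
a == b = ⌊ a ≟ b ⌋

count : ∀ {n} → (Fin n → Bool) → ℕ
count {n} P = length (filterᵇ P (allFin n))

_∈_ : ∀ {n} → Fin n → (Fin n → Bool) → Set
x ∈ S = T (S x)

_minus_ : ∀ {n} → (Fin n → Bool) → Fin n → (Fin n → Bool)
(S minus t) x = S x ∧ not (x == t)

-- Directed graphs on (a subset of) Fin n, no parallel edges:
-- V = vertex set, E u v = true iff (u,v) is an edge.

record Net (n : ℕ) : Set where
  constructor net
  field
    V    : Fin n → Bool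
    E    : Fin n → Fin n → Bool
    root : Fin n

module _ {n : ℕ} (N : Net n) where
  open Net N

  Edge : Fin n → Fin n → Set
  Edge u v = T (E u v)

  indeg outdeg : Fin n → ℕ
  indeg v  = count (λ u → E u v)
  outdeg u = count (λ v → E u v)

  IsLeaf IsTreeVertex IsReticulation : Fin n → Set
  IsLeaf v         = (indeg v ≡ 1) × (outdeg v ≡ 0)
  IsTreeVertex v   = (indeg v ≡ 1) × (outdeg v ≡ 2)
  IsReticulation v = (indeg v ≡ 2) × (outdeg v ≡ 1)

data Path {n : ℕ} (E : Fin n → Fin n → Bool) : Fin n → Fin n → Set where
  here : ∀ {u} → Path E u u
  step : ∀ {u w v} → T (E u w) → Path E w v → Path E u v

removeEdge : ∀ {n} → (Fin n → Fin n → Bool) → Fin n → Fin n → (Fin n → Fin n → Bool)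
removeEdge E a b u v = E u v ∧ not ((u == a) ∧ (v == b))

module _ {n : ℕ} (N : Net n) where
  open Net N

  Acyclic : Set
  Acyclic = ∀ u v → T (E u v) → ¬ Path E v u

  IsShortcut : Fin n → Fin n → Set
  IsShortcut u v = T (E u v) × Path (removeEdge E u v) u v

  -- N is a phylogenetic network on X ∪ {r}; leaf labelled x ∈ X is lab x,
  -- the leaf r is the vertex r.
  IsPhyloNetworkOn : ∀ {m : ℕ} → (X : Fin m → Bool) (lab : Fin m → Fin n) (r : Fin n) → Set
  IsPhyloNetworkOn {m} X lab r =
      (∀ u v → T (E u v) → (u ∈ V) × (v ∈ V))
    × (root ∈ V) × (indeg N root ≡ 0) × (outdeg N root ≡ 2)
    × (∀ v → v ∈ V → Path E root v)
    × Acyclic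
    × (∀ v → v ∈ V → v ≢ root → IsTreeVertex N v ⊎ IsReticulation N v ⊎ IsLeaf N v)
    × (r ∈ V) × (∀ x → x ∈ X → lab x ∈ V)
    × (∀ x y → x ∈ X → y ∈ X → lab x ≡ lab y → x ≡ y)
    × (∀ x → x ∈ X → lab x ≢ r)
    × (∀ v → v ∈ V → outdeg N v ≡ 0 → (v ≡ r) ⊎ Σ (Fin m) (λ x → x ∈ X × lab x ≡ v))
    × (outdeg N r ≡ 0) × (indeg N r ≡ 1)
    × (∀ x → x ∈ X → (outdeg N (lab x) ≡ 0) × (indeg N (lab x) ≡ 1))

  IsTreeChild : Set
  IsTreeChild = ∀ v → v ∈ V → outdeg N v ≢ 0 →
                Σ (Fin n) (λ c → T (E v c) × (IsTreeVertex N c ⊎ IsLeaf N c))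

  IsNormal : Set
  IsNormal = IsTreeChild × (∀ u v → ¬ IsShortcut u v)

  IsOutgroup : Fin n → Set
  IsOutgroup r = T (E root r)

module _ (ℝ : RealField) where
  open RealField ℝ

  Weighting : ℕ → Set
  Weighting n = Fin n → Fin n → Carrier

  sumF : ∀ {k} → (Fin k → Carrier) → Carrier
  sumF {zero}  f = 0#
  sumF {suc k} f = f zero + sumF (λ j → f (suc j))

  -- a weighting: non-negative on edges, strictly positive on tree edges
  -- (edges whose head is not a reticulation); reticulation-pair: the two
  -- edges into a reticulation have equal weight
  IsRetPairWeighting : ∀ {n} → Net n → Weighting n → Set
  IsRetPairWeighting N w =
      (∀ u v → Edge N u v → 0# ≤ w u v)
    × (∀ u v → Edge N u v → ¬ IsReticulation N v → 0# < w u v)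
    × (∀ u₁ u₂ v → IsReticulation N v → Edge N u₁ v → Edge N u₂ v → w u₁ v ≡ w u₂ v)

  -- an up-down path u₀ = a, …, u_k = b (distinct vertices) with apex u_i:
  -- edges (u_{j+1},u_j) for j < i and (u_j,u_{j+1}) for j ≥ i
  record UpDownPath {n} (N : Net n) (a b : Fin n) : Set where
    field
      k     : ℕ
      u     : Fin (suc k) → Fin n
      apex  : Fin (suc k)
      u-inj : Injective _≡_ _≡_ u
      start : u zero ≡ a
      end   : u (Data.Fin.fromℕ k) ≡ b
      edges : ∀ (j : Fin k) →
              if toℕ j <ᵇ toℕ apex
              then Edge N (u (suc j)) (u (inject₁ j))
              else Edge N (u (inject₁ j)) (u (suc j))

  udLength : ∀ {n} {N : Net n} {a b} → Weighting n → UpDownPath N a b → Carrier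
  udLength w p = sumF (λ j → if toℕ j <ᵇ toℕ apex
                             then w (u (suc j)) (u (inject₁ j))
                             else w (u (inject₁ j)) (u (suc j)))
    where open UpDownPath p

  IsMinDist IsMaxDist : ∀ {n} → Net n → Weighting n → Fin n → Fin n → Carrier → Set
  IsMinDist N w a b d = Σ (UpDownPath N a b) (λ p → udLength w p ≡ d)
                        × (∀ (p : UpDownPath N a b) → d ≤ udLength w p)
  IsMaxDist N w a b d = Σ (UpDownPath N a b) (λ p → udLength w p ≡ d)
                        × (∀ (p : UpDownPath N a b) → udLength w p ≤ d)

  -- 2·Q_r(x,y) = d_max(r,x) + d_max(r,y) − d_min(x,y)
  twoQ : ∀ {m} → (Fin m → Fin m → Carrier) → (Fin m → Carrier) → Fin m → Fin m → Carrier
  twoQ D dmax x y = dmax x + dmax y - D x y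

  -- Reducing t in the cherry {s,t}: ls, lt the leaves, p = p_s = p_t, g = g_s.
  reduceNet : ∀ {n} → Net n → Weighting n → (p g ls lt : Fin n) → Net n × Weighting n
  reduceNet (net V E root) w p g ls lt =
      net (λ v → V v ∧ not (v == lt) ∧ not (v == p))
          (λ a b → (E a b ∧ not ((a == p) ∨ (b == p) ∨ (a == lt) ∨ (b == lt)))
                   ∨ ((a == g) ∧ (b == ls)))
          root
    , (λ a b → if (a == g) ∧ (b == ls) then w g p + w p ls else w a b)

  -- Isolating the reticulated cherry {s,t} (reticulation leaf t):
  -- ps = p_s, pt = p_t, gt = g_t, gt' = parent of g_t, h = other child of g_t.
  isolateNet : ∀ {n} → Net n → Weighting n → (ps pt gt gt' h ls lt : Fin n) → Net n × Weighting n
  isolateNet (net V E root) w ps pt gt gt' h ls lt =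
      net (λ v → V v ∧ not (v == gt) ∧ not (v == pt))
          (λ a b → (E a b ∧ not ((a == gt) ∨ (b == gt) ∨ (a == pt) ∨ (b == pt)))
                   ∨ ((a == ps) ∧ (b == lt))
                   ∨ ((a == gt') ∧ (b == h)))
          root
    , (λ a b → if (a == ps) ∧ (b == lt) then w ps pt + w pt lt
               else if (a == gt') ∧ (b == h) then w gt' gt + w gt h
               else w a b)

  isolateD : ∀ {m} → (Fin m → Fin m → Carrier) → (Fin m → Carrier) → (s t : Fin m) →
             Fin m → Fin m → Carrier
  isolateD D dmax s t x y =
    if (x == t) ∧ (y == t) then 0#
    else if ((x == t) ∧ (y == s)) ∨ ((x == s) ∧ (y == t)) then D s t
    else if x == t then D s y + γ
    else if y == t then D s x + γ
    else D x y
    where γ = dmax t - dmax s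

-- Deleting one edge and suppressing the vertices it leaves with a single parent and a single child
-- (adding up the weights of the merged edges) gives a length-preserving correspondence between the
-- up-down paths of the old and the new network that join leaves other than t and avoid the deleted
-- edge. For a cherry nothing more is needed. Isolating a reticulated cherry makes t a sibling of s
-- below p_s with pendant weight w(p_s,p_t) + w(p_t,t), so every distance from t is the corresponding
-- distance from s shifted by w(p_s,p_t) + w(p_t,t) − w(p_s,s), and d_min(s,t) = w(p_s,s) + w(p_s,p_t) +
-- w(p_t,t) because both reticulation edges into p_t have the same weight. It remains to see that the
-- shift is γ = d_max(r,t) − d_max(r,s). Extending a longest path from r to s by p_s → p_t → t gives
-- one inequality. For the other, a longest path from r to t enters p_t from p_s or from g_t; in the
-- second case comparing Q_r(s,t) with Q_r(t,y), for a leaf y below the other child of g_t, gives the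
-- bound.

module Submission where

open import Defs
open import Algebra.Bundles using (CommutativeRing)
open import Data.Bool using (Bool; true; false; T; _∧_; _∨_; not; if_then_else_)
open import Data.Bool.Properties using (T-∧; T-∨)
open import Data.Empty using (⊥; ⊥-elim)
open import Data.Fin using (Fin; zero; suc; toℕ; inject₁; fromℕ; _≟_)
open import Data.Fin.Properties using (suc-injective; pigeonhole; <-irrefl)
open import Data.List using (List; []; _∷_; _++_; length; filterᵇ; allFin; tabulate; lookup)
open import Data.List.Membership.Propositional using () renaming (_∈_ to _∈ₗ_; _∉_ to _∉ₗ_)
open import Data.List.Membership.Propositional.Properties
  using (∈-++⁺ˡ; ∈-++⁻; ∈-filter⁺; ∈-allFin; ∈-tabulate⁺; ∈-tabulate⁻)
open import Data.List.Properties using (length-++; tabulate-lookup)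
open import Data.List.Relation.Unary.Any using (here; there)
open import Data.Nat using (ℕ; zero; suc; _<ᵇ_) renaming (_<_ to _<ℕ_; _+_ to _+ℕ_)
import Data.Nat.Properties as ℕ
open import Data.Product using (Σ; ∃; _×_; _,_; proj₁; proj₂)
open import Data.Sum using (_⊎_; inj₁; inj₂; [_,_]′)
open import Data.Unit using (⊤; tt)
import Data.Vec.Functional as V
open import Function using (case_of_; _∘_)
open import Function.Bundles using (Equivalence)
open import Function.Definitions using (Injective)
open import Level using (0ℓ)
open import Relation.Binary.Bundles using (Poset)
open import Relation.Binary.PropositionalEquality
  using (_≡_; _≢_; refl; sym; trans; cong; cong₂; subst; subst₂; module ≡-Reasoning)
import Relation.Binary.Reasoning.PartialOrder
open import Relation.Binary.Structures using (IsTotalOrder)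
open import Relation.Nullary using (¬_; yes; no)
open import Relation.Nullary.Decidable using (toWitness; fromWitness; T?)

open Equivalence using (to; from)

T-∧⁻ : ∀ {x y} → T (x ∧ y) → T x × T y
T-∧⁻ = to T-∧

T-∧⁺ : ∀ {x y} → T x → T y → T (x ∧ y)
T-∧⁺ p q = from T-∧ (p , q)

T-∨⁻ : ∀ {x y} → T (x ∨ y) → T x ⊎ T y
T-∨⁻ = to T-∨

T-∨⁺ˡ : ∀ {x y} → T x → T (x ∨ y)
T-∨⁺ˡ p = from T-∨ (inj₁ p)

T-∨⁺ʳ : ∀ {x y} → T y → T (x ∨ y)
T-∨⁺ʳ q = from T-∨ (inj₂ q)

T-not⁻ : ∀ {x} → T (not x) → ¬ T x
T-not⁻ {false} _ ()

T-not⁺ : ∀ {x} → ¬ T x → T (not x)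
T-not⁺ {false} _ = tt
T-not⁺ {true}  f = f tt

==⇒≡ : ∀ {n} {a b : Fin n} → T (a == b) → a ≡ b
==⇒≡ {a = a} {b} = toWitness {a? = a ≟ b}

≡⇒== : ∀ {n} {a b : Fin n} → a ≡ b → T (a == b)
≡⇒== {a = a} {b} = fromWitness {a? = a ≟ b}

≢⇒¬== : ∀ {n} {a b : Fin n} → a ≢ b → ¬ T (a == b)
≢⇒¬== a≢b p = a≢b (==⇒≡ p)

¬==⇒≢ : ∀ {n} {a b : Fin n} → ¬ T (a == b) → a ≢ b
¬==⇒≢ f a≡b = f (≡⇒== a≡b)

==-pair : ∀ {n} {a b c d : Fin n} → T ((a == c) ∧ (b == d)) → a ≡ c × b ≡ d
==-pair p = ==⇒≡ (proj₁ (T-∧⁻ p)) , ==⇒≡ (proj₂ (T-∧⁻ p))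

==-pair-refl : ∀ {n} (a b : Fin n) → T ((a == a) ∧ (b == b))
==-pair-refl a b = T-∧⁺ (≡⇒== {a = a} refl) (≡⇒== {a = b} refl)

T-nor₄⁺ : ∀ {b₁ b₂ b₃ b₄} → ¬ T b₁ → ¬ T b₂ → ¬ T b₃ → ¬ T b₄ →
          T (not (b₁ ∨ b₂ ∨ b₃ ∨ b₄))
T-nor₄⁺ {true}                   n₁ _  _  _  = n₁ tt
T-nor₄⁺ {false} {true}           _  n₂ _  _  = n₂ tt
T-nor₄⁺ {false} {false} {true}   _  _  n₃ _  = n₃ tt
T-nor₄⁺ {false} {false} {false}  _  _  _  n₄ = T-not⁺ n₄

T-nor₄⁻ : ∀ {b₁ b₂ b₃ b₄} → T (not (b₁ ∨ b₂ ∨ b₃ ∨ b₄)) →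
          ¬ T b₁ × ¬ T b₂ × ¬ T b₃ × ¬ T b₄
T-nor₄⁻ {false} {false} {false} {false} _ = (λ ()) , (λ ()) , (λ ()) , (λ ())

if-true : ∀ {A : Set} {c} {x y : A} → T c → (if c then x else y) ≡ x
if-true {c = true} _ = refl

if-false : ∀ {A : Set} {c} {x y : A} → ¬ T c → (if c then x else y) ≡ y
if-false {c = false} _ = refl
if-false {c = true}  f = ⊥-elim (f tt)

Uniq : ∀ {A : Set} → List A → Set
Uniq []       = ⊤
Uniq (x ∷ xs) = x ∉ₗ xs × Uniq xs

Uniq-++ˡ : ∀ {A : Set} (xs : List A) {ys} → Uniq (xs ++ ys) → Uniq xs
Uniq-++ˡ []       _        = tt
Uniq-++ˡ (x ∷ xs) (x∉ , u) = (λ m → x∉ (∈-++⁺ˡ m)) , Uniq-++ˡ xs u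

Uniq-∷ʳ : ∀ {A : Set} (xs : List A) {y} → Uniq xs → y ∉ₗ xs → Uniq (xs ++ y ∷ [])
Uniq-∷ʳ []       _        _  = (λ ()) , tt
Uniq-∷ʳ (x ∷ xs) (x∉ , u) y∉ = x∉xs++y , Uniq-∷ʳ xs u (λ m → y∉ (there m))
  where
  x∉xs++y : x ∉ₗ xs ++ _ ∷ []
  x∉xs++y m with ∈-++⁻ xs m
  ... | inj₁ m′         = x∉ m′
  ... | inj₂ (here refl) = y∉ (here refl)

Uniq-tabulate : ∀ {A : Set} {k} (u : Fin k → A) → Injective _≡_ _≡_ u → Uniq (tabulate u)
Uniq-tabulate {k = zero}  u inj = tt
Uniq-tabulate {k = suc k} u inj =
  (λ m → 0≢suc (∈-tabulate⁻ m)) , Uniq-tabulate (λ j → u (suc j)) (λ e → suc-injective (inj e))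
  where
  0≢suc : ¬ ∃ λ i → u zero ≡ u (suc i)
  0≢suc (i , e) with inj e
  ... | ()

Uniq-tabulate⇒injective : ∀ {A : Set} {k} (u : Fin k → A) → Uniq (tabulate u) → Injective _≡_ _≡_ u
Uniq-tabulate⇒injective u uq {zero}  {zero}  e = refl
Uniq-tabulate⇒injective u (u₀∉ , _) {zero}  {suc j} e =
  ⊥-elim (u₀∉ (subst (_∈ₗ tabulate (λ j → u (suc j))) (sym e) (∈-tabulate⁺ j)))
Uniq-tabulate⇒injective u (u₀∉ , _) {suc i} {zero}  e =
  ⊥-elim (u₀∉ (subst (_∈ₗ tabulate (λ j → u (suc j))) e (∈-tabulate⁺ i)))
Uniq-tabulate⇒injective u (_ , uq) {suc i} {suc j} e =
  cong suc (Uniq-tabulate⇒injective (λ j → u (suc j)) uq e)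

Uniq⇒length≤ : ∀ {n} (l : List (Fin n)) → Uniq l → ¬ (n <ℕ length l)
Uniq⇒length≤ l uq n<len with pigeonhole n<len (lookup l)
... | i , j , i<j , eq = <-irrefl (lookup-injective eq) i<j
  where
  lookup-injective : Injective _≡_ _≡_ (lookup l)
  lookup-injective = Uniq-tabulate⇒injective (lookup l) (subst Uniq (sym (tabulate-lookup l)) uq)

∈-minus⁻ : ∀ {m} (X : Fin m → Bool) {x t} → x ∈ (X minus t) → x ∈ X × x ≢ t
∈-minus⁻ X {x} h = proj₁ (T-∧⁻ h) , λ x≡t → T-not⁻ (proj₂ (T-∧⁻ {X x} h)) (≡⇒== x≡t)

length≡0⇒∉ : ∀ {A : Set} (l : List A) {x} → length l ≡ 0 → x ∉ₗ l
length≡0⇒∉ [] _ ()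

length≡1⇒≡ : ∀ {A : Set} (l : List A) {x y} → length l ≡ 1 → x ∈ₗ l → y ∈ₗ l → x ≡ y
length≡1⇒≡ (a ∷ []) _ (here p) (here q) = trans p (sym q)

length≡2⇒one-of : ∀ {A : Set} (l : List A) {x y v} → length l ≡ 2 → x ∈ₗ l → y ∈ₗ l → x ≢ y →
                  v ∈ₗ l → v ≡ x ⊎ v ≡ y
length≡2⇒one-of (a ∷ b ∷ []) _ (here refl)         (here refl)         x≢y _ = ⊥-elim (x≢y refl)
length≡2⇒one-of (a ∷ b ∷ []) _ (here refl)         (there (here refl)) _ (here refl)         = inj₁ refl
length≡2⇒one-of (a ∷ b ∷ []) _ (here refl)         (there (here refl)) _ (there (here refl)) = inj₂ refl
length≡2⇒one-of (a ∷ b ∷ []) _ (there (here refl)) (here refl)         _ (here refl)         = inj₂ refl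
length≡2⇒one-of (a ∷ b ∷ []) _ (there (here refl)) (here refl)         _ (there (here refl)) = inj₁ refl
length≡2⇒one-of (a ∷ b ∷ []) _ (there (here refl)) (there (here refl)) x≢y _ = ⊥-elim (x≢y refl)

module _ {n : ℕ} (P : Fin n → Bool) where

  private
    ∈-filter : ∀ {v} → T (P v) → v ∈ₗ filterᵇ P (allFin n)
    ∈-filter {v} p = ∈-filter⁺ (λ x → T? (P x)) (∈-allFin v) p

  count≡0⇒¬ : count P ≡ 0 → ∀ {v} → ¬ T (P v)
  count≡0⇒¬ c p = length≡0⇒∉ _ c (∈-filter p)

  count≡1⇒≡ : count P ≡ 1 → ∀ {u v} → T (P u) → T (P v) → u ≡ v
  count≡1⇒≡ c p q = length≡1⇒≡ _ c (∈-filter p) (∈-filter q)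

  count≡2⇒one-of : count P ≡ 2 → ∀ {u v x} → T (P u) → T (P v) → u ≢ v → T (P x) → x ≡ u ⊎ x ≡ v
  count≡2⇒one-of c p q u≢v r = length≡2⇒one-of _ c (∈-filter p) (∈-filter q) u≢v (∈-filter r)

module _ {n : ℕ} {E : Fin n → Fin n → Bool} where

  vertices tailVertices : ∀ {a b} → Path E a b → List (Fin n)
  vertices {a} P = a ∷ tailVertices P
  tailVertices here       = []
  tailVertices (step e P) = vertices P

  infixl 5 _▷_
  _▷_ : ∀ {a b c} → Path E a b → T (E b c) → Path E a c
  here     ▷ e = step e here
  step e P ▷ f = step e (P ▷ f)

  infixr 5 _++ₚ_
  _++ₚ_ : ∀ {a b c} → Path E a b → Path E b c → Path E a c
  here     ++ₚ Q = Q
  step e P ++ₚ Q = step e (P ++ₚ Q)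

  tailVertices-▷ : ∀ {a b c} (P : Path E a b) (e : T (E b c)) →
                   tailVertices (P ▷ e) ≡ tailVertices P ++ c ∷ []
  tailVertices-▷ here       e = refl
  tailVertices-▷ (step f P) e = cong (_ ∷_) (tailVertices-▷ P e)

  data SnocView {a} : ∀ {b} → Path E a b → Set where
    [] : SnocView here
    _∷ʳ_ : ∀ {y b} (P : Path E a y) (e : T (E y b)) → SnocView (P ▷ e)

  snocView : ∀ {a b} (P : Path E a b) → SnocView P
  snocView here = []
  snocView (step e P) with snocView P
  ... | []      = here ∷ʳ e
  ... | Q ∷ʳ f  = step e Q ∷ʳ f

  data LastEdge {a} : ∀ {b} → Path E a b → Set where
    _∷ʳ_ : ∀ {y b} (P : Path E a y) (e : T (E y b)) → LastEdge (P ▷ e)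

  lastEdge : ∀ {a b} (P : Path E a b) → a ≢ b → LastEdge P
  lastEdge P a≢b with snocView P
  ... | []     = ⊥-elim (a≢b refl)
  ... | Q ∷ʳ e = Q ∷ʳ e

  prefix : ∀ {a b v} (P : Path E a b) → v ∈ₗ vertices P → Path E a v
  prefix P          (here refl) = here
  prefix (step e P) (there m)   = step e (prefix P m)

  suffix : ∀ {a b v} (P : Path E a b) → v ∈ₗ vertices P → Path E v b
  suffix P          (here refl) = P
  suffix (step e P) (there m)   = suffix P m

  successor : ∀ {a b v} (P : Path E a b) → v ∈ₗ vertices P → v ≢ b →
              Σ (Fin n) λ c → T (E v c) × c ∈ₗ tailVertices P
  successor here                 (here refl) v≢b = ⊥-elim (v≢b refl)
  successor (step {w = c} e P)   (here refl) _   = c , e , here refl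
  successor (step e P)           (there m)   v≢b with successor P m v≢b
  ... | c , f , m′ = c , f , there m′

  sink-is-end : ∀ {a b v} (P : Path E a b) → (∀ u → ¬ T (E v u)) → v ∈ₗ vertices P → v ≡ b
  sink-is-end here                 _    (here refl) = refl
  sink-is-end (step {w = c} e P)   sink (here refl) = ⊥-elim (sink c e)
  sink-is-end (step e P)           sink (there m)   = sink-is-end P sink m

  source-has-edge : ∀ {a b} (P : Path E a b) → a ≢ b → Σ (Fin n) λ c → T (E a c)
  source-has-edge here               a≢b = ⊥-elim (a≢b refl)
  source-has-edge (step {w = c} e P) _   = c , e

  acyclic⇒Uniq : (∀ u v → T (E u v) → ¬ Path E v u) → ∀ {a b} (P : Path E a b) → Uniq (vertices P)
  acyclic⇒Uniq acyc here               = (λ ()) , tt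
  acyclic⇒Uniq acyc (step {u} {w} e P) = (λ m → acyc u w e (prefix P m)) , acyclic⇒Uniq acyc P

  avoiding⇒removeEdge : ∀ {x y a b} (P : Path E a b) → x ∉ₗ vertices P → Path (removeEdge E x y) a b
  avoiding⇒removeEdge here _ = here
  avoiding⇒removeEdge (step {u} e P) x∉ =
    step (T-∧⁺ e (T-not⁺ λ p → x∉ (here (sym (proj₁ (==-pair {a = u} p))))))
         (avoiding⇒removeEdge P (λ m → x∉ (there m)))

module _ (ℝ : RealField) where

  open RealField ℝ renaming (Carrier to R)

  private
    commutativeRing : CommutativeRing 0ℓ 0ℓ
    commutativeRing = record { isCommutativeRing = isCommutativeRing }

  open CommutativeRing commutativeRing
    using (+-assoc; +-comm; +-identityˡ; +-identityʳ; -‿inverseˡ; +-commutativeMonoid; +-group)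
  open import Algebra.Solver.CommutativeMonoid +-commutativeMonoid using (solve; _⊜_; _⊕_)
  open IsTotalOrder isTotalOrder
    using () renaming (trans to ≤-trans; reflexive to ≤-reflexive; antisym to ≤-antisym)
  open import Algebra.Properties.Group +-group using (//-rightDividesʳ; quasigroup)
  open import Algebra.Properties.Quasigroup quasigroup using (cancelʳ)

  private
    poset : Poset 0ℓ 0ℓ 0ℓ
    poset = record { isPartialOrder = IsTotalOrder.isPartialOrder isTotalOrder }

  module ≤-Reasoning = Relation.Binary.Reasoning.PartialOrder poset

  ≤-refl : ∀ {x} → x ≤ x
  ≤-refl = ≤-reflexive refl

  +-monoʳ-≤ : ∀ {x y} z → x ≤ y → z + x ≤ z + y
  +-monoʳ-≤ {x} {y} z x≤y = subst₂ _≤_ (+-comm x z) (+-comm y z) (+-monoˡ-≤ z x≤y)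

  +-mono-≤ : ∀ {a b c d} → a ≤ b → c ≤ d → a + c ≤ b + d
  +-mono-≤ {b = b} {c = c} a≤b c≤d = ≤-trans (+-monoˡ-≤ c a≤b) (+-monoʳ-≤ b c≤d)

  x+y-y≡x : ∀ x y → (x + y) - y ≡ x
  x+y-y≡x x y = //-rightDividesʳ y x

  +-cancelʳ-≡ : ∀ {x y} z → x + z ≡ y + z → x ≡ y
  +-cancelʳ-≡ {x} {y} z = cancelʳ z x y

  +-cancelʳ-≤ : ∀ {x y} z → x + z ≤ y + z → x ≤ y
  +-cancelʳ-≤ {x} {y} z le = subst₂ _≤_ (x+y-y≡x x z) (x+y-y≡x y z) (+-monoˡ-≤ (- z) le)

  +-cancelˡ-≤ : ∀ {x y} z → z + x ≤ z + y → x ≤ y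
  +-cancelˡ-≤ {x} {y} z le = +-cancelʳ-≤ z (subst₂ _≤_ (+-comm z x) (+-comm z y) le)

  +-nonneg : ∀ {x y} → 0# ≤ x → 0# ≤ y → 0# ≤ x + y
  +-nonneg 0≤x 0≤y = subst₂ _≤_ (+-identityʳ 0#) refl (+-mono-≤ 0≤x 0≤y)

  x≤y+x : ∀ {y} x → 0# ≤ y → x ≤ y + x
  x≤y+x {y} x 0≤y = subst₂ _≤_ (+-identityˡ x) refl (+-monoˡ-≤ x 0≤y)

  x-y≤z-w⇒x+w≤z+y : ∀ {x y z w} → x - y ≤ z - w → x + w ≤ z + y
  x-y≤z-w⇒x+w≤z+y {x} {y} {z} {w} le =
    subst₂ _≤_ (x-a+[a+b]≡x+b x y w) (trans (cong ((z - w) +_) (+-comm y w)) (x-a+[a+b]≡x+b z w y))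
      (+-monoˡ-≤ (y + w) le)
    where
    x-a+[a+b]≡x+b : ∀ x a b → (x - a) + (a + b) ≡ x + b
    x-a+[a+b]≡x+b x a b = begin
      (x - a) + (a + b)
        ≡⟨ solve 4 (λ x -a a b → ((x ⊕ -a) ⊕ (a ⊕ b)) ⊜ ((x ⊕ b) ⊕ (-a ⊕ a))) refl x (- a) a b ⟩
      (x + b) + (- a + a)   ≡⟨ cong ((x + b) +_) (-‿inverseˡ a) ⟩
      (x + b) + 0#          ≡⟨ +-identityʳ (x + b) ⟩
      x + b                 ∎
      where open ≡-Reasoning

  module _ {n : ℕ} {E : Fin n → Fin n → Bool} (w : Weighting ℝ n) where

    pathLength : ∀ {a b} → Path E a b → R
    pathLength here               = 0#
    pathLength (step {u} {v} e P) = w u v + pathLength P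

    pathLength-▷ : ∀ {a b c} (P : Path E a b) (e : T (E b c)) → pathLength (P ▷ e) ≡ pathLength P + w b c
    pathLength-▷ {b = b} {c} here e = trans (+-identityʳ (w b c)) (sym (+-identityˡ (w b c)))
    pathLength-▷ (step {u} {v} f P) e = trans (cong (w u v +_) (pathLength-▷ P e)) (sym (+-assoc _ _ _))

    pathLength-▷▷ : ∀ {a b c d} (P : Path E a b) (e : T (E b c)) (f : T (E c d)) →
                    pathLength (P ▷ e ▷ f) ≡ (pathLength P + w b c) + w c d
    pathLength-▷▷ P e f = trans (pathLength-▷ (P ▷ e) f) (cong (_+ w _ _) (pathLength-▷ P e))

    pathLength-++ : ∀ {a b c} (P : Path E a b) (Q : Path E b c) →
                    pathLength (P ++ₚ Q) ≡ pathLength P + pathLength Q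
    pathLength-++ here               Q = sym (+-identityˡ _)
    pathLength-++ (step {u} {v} e P) Q = trans (cong (w u v +_) (pathLength-++ P Q)) (sym (+-assoc _ _ _))

    pathLength-nonneg : (∀ u v → T (E u v) → 0# ≤ w u v) → ∀ {a b} (P : Path E a b) → 0# ≤ pathLength P
    pathLength-nonneg nonneg here               = ≤-refl
    pathLength-nonneg nonneg (step {u} {v} e P) = +-nonneg (nonneg u v e) (pathLength-nonneg nonneg P)

  -- An up-down path from a to b with apex c, as its two downward arms c ⇝ a and c ⇝ b;
  -- vertex-disjointness of the arms apart from c makes the combined walk simple.
  record Arms {n : ℕ} (E : Fin n → Fin n → Bool) (a b : Fin n) : Set where
    constructor arms
    field
      apex       : Fin n
      left       : Path E apex a
      right      : Path E apex b
      left-uniq  : Uniq (vertices left)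
      right-uniq : Uniq (vertices right)
      disjoint   : ∀ v → v ∈ₗ tailVertices left → v ∈ₗ tailVertices right → ⊥

  armsLength : ∀ {n} {E : Fin n → Fin n → Bool} (w : Weighting ℝ n) {a b} → Arms E a b → R
  armsLength w A = pathLength w (Arms.left A) + pathLength w (Arms.right A)

  flipArms : ∀ {n} {E : Fin n → Fin n → Bool} {a b} → Arms E a b → Arms E b a
  flipArms (arms c P Q uP uQ dj) = arms c Q P uQ uP (λ v m₁ m₂ → dj v m₂ m₁)

  flipArms-length : ∀ {n} {E : Fin n → Fin n → Bool} (w : Weighting ℝ n) {a b} (A : Arms E a b) →
                    armsLength w (flipArms A) ≡ armsLength w A
  flipArms-length w (arms c P Q _ _ _) = +-comm _ _

  data UpDown {n : ℕ} (E : Fin n → Fin n → Bool) : Fin n → Fin n → Set where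
    down : ∀ {a b} → Path E a b → UpDown E a b
    up   : ∀ {a c b} → T (E c a) → UpDown E c b → UpDown E a b

  upDownVertices : ∀ {n} {E : Fin n → Fin n → Bool} {a b} → UpDown E a b → List (Fin n)
  upDownVertices (down P)          = vertices P
  upDownVertices {a = a} (up e U) = a ∷ upDownVertices U

  upDownLength : ∀ {n} {E : Fin n → Fin n → Bool} (w : Weighting ℝ n) {a b} → UpDown E a b → R
  upDownLength w (down P)           = pathLength w P
  upDownLength w (up {a} {c} e U)   = w c a + upDownLength w U

  module _ {n : ℕ} {E : Fin n → Fin n → Bool} (w : Weighting ℝ n) where

    UpDown⇒Arms : ∀ {a b} (U : UpDown E a b) → Uniq (upDownVertices U) →
                  Σ (Arms E a b) λ A → (armsLength w A ≡ upDownLength w U) ×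
                    (∀ v → v ∈ₗ tailVertices (Arms.left A) ⊎ v ∈ₗ vertices (Arms.right A) →
                           v ∈ₗ upDownVertices U)
    UpDown⇒Arms {a} (down Q) uQ = arms a here Q ((λ ()) , tt) uQ (λ v ()) , +-identityˡ _ , on-U
      where
      on-U : ∀ v → v ∈ₗ [] ⊎ v ∈ₗ vertices Q → v ∈ₗ vertices Q
      on-U v (inj₂ m) = m
    UpDown⇒Arms {a} (up {c = c} e U) (a∉ , uU) with UpDown⇒Arms U uU
    ... | arms c₀ P Q uP uQ dj , len , on-U = arms c₀ (P ▷ e) Q uP′ uQ dj′ , len′ , on-U′
      where
      tail-P▷e : tailVertices (P ▷ e) ≡ tailVertices P ++ a ∷ []
      tail-P▷e = tailVertices-▷ P e
      uP′ : Uniq (vertices (P ▷ e))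
      uP′ rewrite tail-P▷e =
        (λ m → c₀∉ (∈-++⁻ (tailVertices P) m)) ,
        Uniq-∷ʳ (tailVertices P) (proj₂ uP) (λ m → a∉ (on-U a (inj₁ m)))
        where
        c₀∉ : c₀ ∈ₗ tailVertices P ⊎ c₀ ∈ₗ a ∷ [] → ⊥
        c₀∉ (inj₁ m)           = proj₁ uP m
        c₀∉ (inj₂ (here refl)) = a∉ (on-U a (inj₂ (here refl)))
      dj′ : ∀ v → v ∈ₗ tailVertices (P ▷ e) → v ∈ₗ tailVertices Q → ⊥
      dj′ v m₁ m₂ rewrite tail-P▷e with ∈-++⁻ (tailVertices P) m₁
      ... | inj₁ m           = dj v m m₂
      ... | inj₂ (here refl) = a∉ (on-U a (inj₂ (there m₂)))
      on-U′ : ∀ v → v ∈ₗ tailVertices (P ▷ e) ⊎ v ∈ₗ vertices Q → v ∈ₗ a ∷ upDownVertices U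
      on-U′ v (inj₁ m) rewrite tail-P▷e with ∈-++⁻ (tailVertices P) m
      ... | inj₁ m′          = there (on-U v (inj₁ m′))
      ... | inj₂ (here refl) = here refl
      on-U′ v (inj₂ m) = there (on-U v (inj₂ m))
      len′ : pathLength w (P ▷ e) + pathLength w Q ≡ w c a + upDownLength w U
      len′ = begin
        pathLength w (P ▷ e) + pathLength w Q        ≡⟨ cong (_+ pathLength w Q) (pathLength-▷ w P e) ⟩
        (pathLength w P + w c a) + pathLength w Q    ≡⟨ solve 3 (λ p x q → ((p ⊕ x) ⊕ q) ⊜ (x ⊕ (p ⊕ q))) refl
                                                               (pathLength w P) (w c a) (pathLength w Q) ⟩
        w c a + (pathLength w P + pathLength w Q)    ≡⟨ cong (w c a +_) len ⟩
        w c a + upDownLength w U                     ∎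
        where open ≡-Reasoning

    prependUp : ∀ {c a b} → Path E c a → UpDown E c b → UpDown E a b
    prependUp here       U = U
    prependUp (step e P) U = prependUp P (up e U)

    prependUp-uniq : ∀ {c a b} (P : Path E c a) (U : UpDown E c b) → Uniq (upDownVertices U) →
                     Uniq (tailVertices P) → (∀ v → v ∈ₗ tailVertices P → v ∈ₗ upDownVertices U → ⊥) →
                     Uniq (upDownVertices (prependUp P U))
    prependUp-uniq here                   U uU _        _  = uU
    prependUp-uniq (step {w = v} e P) U uU (v∉ , uP) dj =
      prependUp-uniq P (up e U) ((λ m → dj v (here refl) m) , uU) uP dj′
      where
      dj′ : ∀ x → x ∈ₗ tailVertices P → x ∈ₗ v ∷ upDownVertices U → ⊥
      dj′ x m (here refl) = v∉ m
      dj′ x m (there m₂)  = dj x (there m) m₂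

    prependUp-length : ∀ {c a b} (P : Path E c a) (U : UpDown E c b) →
                       upDownLength w (prependUp P U) ≡ pathLength w P + upDownLength w U
    prependUp-length here U = sym (+-identityˡ _)
    prependUp-length (step {u = c} {w = v} e P) U =
      trans (prependUp-length P (up e U))
            (solve 3 (λ p x q → (p ⊕ (x ⊕ q)) ⊜ ((x ⊕ p) ⊕ q)) refl (pathLength w P) (w c v) (upDownLength w U))

    Arms⇒UpDown : ∀ {a b} (A : Arms E a b) →
                  Σ (UpDown E a b) λ U → Uniq (upDownVertices U) × (upDownLength w U ≡ armsLength w A)
    Arms⇒UpDown (arms c P Q uP uQ dj) =
      prependUp P (down Q) , prependUp-uniq P (down Q) uQ (proj₂ uP) dj′ , prependUp-length P (down Q)
      where
      dj′ : ∀ v → v ∈ₗ tailVertices P → v ∈ₗ vertices Q → ⊥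
      dj′ v m (here refl) = proj₁ uP m
      dj′ v m (there m₂)  = dj v m m₂

  module Sequences {n : ℕ} (N : Net n) (w : Weighting ℝ n) where
    open Net N using (E)

    EdgeAt : ∀ {k} (u : Fin (suc k) → Fin n) (i : Fin (suc k)) → Fin k → Set
    EdgeAt u i j = if toℕ j <ᵇ toℕ i then Edge N (u (suc j)) (u (inject₁ j))
                                      else Edge N (u (inject₁ j)) (u (suc j))

    weightAt : ∀ {k} (u : Fin (suc k) → Fin n) (i : Fin (suc k)) → Fin k → R
    weightAt u i j = if toℕ j <ᵇ toℕ i then w (u (suc j)) (u (inject₁ j))
                                        else w (u (inject₁ j)) (u (suc j))

    seqPath : ∀ k (u : Fin (suc k) → Fin n) → (∀ (j : Fin k) → T (E (u (inject₁ j)) (u (suc j)))) →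
              Path E (u zero) (u (fromℕ k))
    seqPath zero    u ed = here
    seqPath (suc k) u ed = step (ed zero) (seqPath k (λ j → u (suc j)) (λ j → ed (suc j)))

    seqPath-vertices : ∀ k u ed → vertices (seqPath k u ed) ≡ tabulate u
    seqPath-vertices zero    u ed = refl
    seqPath-vertices (suc k) u ed = cong (u zero ∷_) (seqPath-vertices k (λ j → u (suc j)) (λ j → ed (suc j)))

    seqPath-length : ∀ k u ed → pathLength w (seqPath k u ed) ≡ sumF ℝ (λ j → w (u (inject₁ j)) (u (suc j)))
    seqPath-length zero    u ed = refl
    seqPath-length (suc k) u ed =
      cong (w (u zero) (u (suc zero)) +_) (seqPath-length k (λ j → u (suc j)) (λ j → ed (suc j)))

    seqUpDown : ∀ k (u : Fin (suc k) → Fin n) (i : Fin (suc k)) → (∀ j → EdgeAt u i j) →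
                UpDown E (u zero) (u (fromℕ k))
    seqUpDown k       u zero    ed = down (seqPath k u ed)
    seqUpDown (suc k) u (suc i) ed = up (ed zero) (seqUpDown k (λ j → u (suc j)) i (λ j → ed (suc j)))

    seqUpDown-vertices : ∀ k u i ed → upDownVertices (seqUpDown k u i ed) ≡ tabulate u
    seqUpDown-vertices k       u zero    ed = seqPath-vertices k u ed
    seqUpDown-vertices (suc k) u (suc i) ed =
      cong (u zero ∷_) (seqUpDown-vertices k (λ j → u (suc j)) i (λ j → ed (suc j)))

    seqUpDown-length : ∀ k u i ed → upDownLength w (seqUpDown k u i ed) ≡ sumF ℝ (weightAt u i)
    seqUpDown-length k       u zero    ed = seqPath-length k u ed
    seqUpDown-length (suc k) u (suc i) ed =
      cong (w (u (suc zero)) (u zero) +_) (seqUpDown-length k (λ j → u (suc j)) i (λ j → ed (suc j)))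

    UpDownPath⇒UpDown : ∀ {a b} (p : UpDownPath ℝ N a b) →
                        Σ (UpDown E a b) λ U → Uniq (upDownVertices U) × (upDownLength w U ≡ udLength ℝ w p)
    UpDownPath⇒UpDown record { k = k ; u = u ; apex = i ; u-inj = inj ; start = refl ; end = refl ; edges = ed } =
      seqUpDown k u i ed ,
      subst Uniq (sym (seqUpDown-vertices k u i ed)) (Uniq-tabulate u inj) ,
      seqUpDown-length k u i ed

    record PathSeq (a b : Fin n) (L : List (Fin n)) (ℓ : R) : Set where
      field
        k   : ℕ
        u   : Fin (suc k) → Fin n
        ed  : ∀ (j : Fin k) → T (E (u (inject₁ j)) (u (suc j)))
        st  : u zero ≡ a
        en  : u (fromℕ k) ≡ b
        tab : tabulate u ≡ L
        len : sumF ℝ (λ j → w (u (inject₁ j)) (u (suc j))) ≡ ℓ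

    record UpDownSeq (a b : Fin n) (L : List (Fin n)) (ℓ : R) : Set where
      field
        k   : ℕ
        u   : Fin (suc k) → Fin n
        i   : Fin (suc k)
        ed  : ∀ j → EdgeAt u i j
        st  : u zero ≡ a
        en  : u (fromℕ k) ≡ b
        tab : tabulate u ≡ L
        len : sumF ℝ (weightAt u i) ≡ ℓ

    pathSeq : ∀ {a b} (P : Path E a b) → PathSeq a b (vertices P) (pathLength w P)
    pathSeq {a} here = record
      { k = 0 ; u = λ _ → a ; ed = λ () ; st = refl ; en = refl ; tab = refl ; len = refl }
    pathSeq {a} (step e P) = record
      { k = suc k ; u = a V.∷ u ; ed = ed′ ; st = refl ; en = en ; tab = cong (a ∷_) tab
      ; len = cong₂ _+_ (cong (w a) st) len }
      where
      open PathSeq (pathSeq P)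
      ed′ : ∀ (j : Fin (suc k)) → T (E ((a V.∷ u) (inject₁ j)) ((a V.∷ u) (suc j)))
      ed′ zero    = subst (λ x → T (E a x)) (sym st) e
      ed′ (suc j) = ed j

    upDownSeq : ∀ {a b} (U : UpDown E a b) → UpDownSeq a b (upDownVertices U) (upDownLength w U)
    upDownSeq (down P) = record { k = k ; u = u ; i = zero ; ed = ed ; st = st ; en = en ; tab = tab ; len = len }
      where open PathSeq (pathSeq P)
    upDownSeq {a} (up e U) = record
      { k = suc k ; u = a V.∷ u ; i = suc i ; ed = ed′ ; st = refl ; en = en ; tab = cong (a ∷_) tab
      ; len = cong₂ _+_ (cong (λ x → w x a) st) len }
      where
      open UpDownSeq (upDownSeq U)
      ed′ : ∀ j → EdgeAt (a V.∷ u) (suc i) j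
      ed′ zero    = subst (λ x → T (E x a)) (sym st) e
      ed′ (suc j) = ed j

    UpDown⇒UpDownPath : ∀ {a b} (U : UpDown E a b) → Uniq (upDownVertices U) →
                        Σ (UpDownPath ℝ N a b) λ p → udLength ℝ w p ≡ upDownLength w U
    UpDown⇒UpDownPath U uU = record
      { k = k ; u = u ; apex = i ; u-inj = Uniq-tabulate⇒injective u (subst Uniq (sym tab) uU)
      ; start = st ; end = en ; edges = ed } , len
      where open UpDownSeq (upDownSeq U)

  IsMinArms IsMaxArms : ∀ {n} → (Fin n → Fin n → Bool) → Weighting ℝ n → Fin n → Fin n → R → Set
  IsMinArms E w a b d = (Σ (Arms E a b) λ A → armsLength w A ≡ d) × (∀ (A : Arms E a b) → d ≤ armsLength w A)
  IsMaxArms E w a b d = (Σ (Arms E a b) λ A → armsLength w A ≡ d) × (∀ (A : Arms E a b) → armsLength w A ≤ d)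

  module _ {n : ℕ} (N : Net n) (w : Weighting ℝ n) where
    open Sequences N w
    open Net N using (E)

    UpDownPath⇒Arms : ∀ {a b} (p : UpDownPath ℝ N a b) → Σ (Arms E a b) λ A → armsLength w A ≡ udLength ℝ w p
    UpDownPath⇒Arms p with UpDownPath⇒UpDown p
    ... | U , uU , len with UpDown⇒Arms w U uU
    ... | A , len′ , _ = A , trans len′ len

    Arms⇒UpDownPath : ∀ {a b} (A : Arms E a b) → Σ (UpDownPath ℝ N a b) λ p → udLength ℝ w p ≡ armsLength w A
    Arms⇒UpDownPath A with Arms⇒UpDown w A
    ... | U , uU , len with UpDown⇒UpDownPath U uU
    ... | p , len′ = p , trans len′ len

    IsMinDist⇒IsMinArms : ∀ {a b d} → IsMinDist ℝ N w a b d → IsMinArms E w a b d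
    IsMinDist⇒IsMinArms ((p , ℓp) , lb) =
      (proj₁ (UpDownPath⇒Arms p) , trans (proj₂ (UpDownPath⇒Arms p)) ℓp) ,
      λ A → subst₂ _≤_ refl (proj₂ (Arms⇒UpDownPath A)) (lb (proj₁ (Arms⇒UpDownPath A)))

    IsMinArms⇒IsMinDist : ∀ {a b d} → IsMinArms E w a b d → IsMinDist ℝ N w a b d
    IsMinArms⇒IsMinDist ((A , ℓA) , lb) =
      (proj₁ (Arms⇒UpDownPath A) , trans (proj₂ (Arms⇒UpDownPath A)) ℓA) ,
      λ p → subst₂ _≤_ refl (proj₂ (UpDownPath⇒Arms p)) (lb (proj₁ (UpDownPath⇒Arms p)))

    IsMaxDist⇒IsMaxArms : ∀ {a b d} → IsMaxDist ℝ N w a b d → IsMaxArms E w a b d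
    IsMaxDist⇒IsMaxArms ((p , ℓp) , ub) =
      (proj₁ (UpDownPath⇒Arms p) , trans (proj₂ (UpDownPath⇒Arms p)) ℓp) ,
      λ A → subst₂ _≤_ (proj₂ (Arms⇒UpDownPath A)) refl (ub (proj₁ (Arms⇒UpDownPath A)))

    IsMaxArms⇒IsMaxDist : ∀ {a b d} → IsMaxArms E w a b d → IsMaxDist ℝ N w a b d
    IsMaxArms⇒IsMaxDist ((A , ℓA) , ub) =
      (proj₁ (Arms⇒UpDownPath A) , trans (proj₂ (Arms⇒UpDownPath A)) ℓA) ,
      λ p → subst₂ _≤_ (proj₂ (UpDownPath⇒Arms p)) refl (ub (proj₁ (UpDownPath⇒Arms p)))

  IsMinArms-sym : ∀ {n} {E : Fin n → Fin n → Bool} {w : Weighting ℝ n} {a b d} →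
                  IsMinArms E w a b d → IsMinArms E w b a d
  IsMinArms-sym {w = w} ((A , ℓA) , lb) =
    (flipArms A , trans (flipArms-length w A) ℓA) ,
    λ B → subst₂ _≤_ refl (flipArms-length w B) (lb (flipArms B))

  LengthPreserving : ∀ {n} → (Fin n → Fin n → Bool) → Weighting ℝ n → (Fin n → Fin n → Bool) → Weighting ℝ n →
                     Fin n → Fin n → Set
  LengthPreserving E w E′ w′ a b = (A : Arms E a b) → Σ (Arms E′ a b) λ A′ → armsLength w′ A′ ≡ armsLength w A

  module _ {n : ℕ} {E E′ : Fin n → Fin n → Bool} {w w′ : Weighting ℝ n} {a b : Fin n}
    (forth : LengthPreserving E w E′ w′ a b) (back : LengthPreserving E′ w′ E w a b) where

    IsMinArms-transfer : ∀ {d} → IsMinArms E w a b d → IsMinArms E′ w′ a b d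
    IsMinArms-transfer ((A , ℓA) , lb) =
      (proj₁ (forth A) , trans (proj₂ (forth A)) ℓA) ,
      λ B → subst₂ _≤_ refl (proj₂ (back B)) (lb (proj₁ (back B)))

    IsMaxArms-transfer : ∀ {d} → IsMaxArms E w a b d → IsMaxArms E′ w′ a b d
    IsMaxArms-transfer ((A , ℓA) , ub) =
      (proj₁ (forth A) , trans (proj₂ (forth A)) ℓA) ,
      λ B → subst₂ _≤_ (proj₂ (back B)) refl (ub (proj₁ (back B)))

  reArm : ∀ {n} {E E′ : Fin n → Fin n → Bool} {a b} (A : Arms E a b)
          {P′ : Path E′ (Arms.apex A) a} {Q′ : Path E′ (Arms.apex A) b} →
          tailVertices P′ ≡ tailVertices (Arms.left A) → tailVertices Q′ ≡ tailVertices (Arms.right A) →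
          Arms E′ a b
  reArm (arms c P Q uP uQ dj) {P′} {Q′} eP eQ =
    arms c P′ Q′ (subst (λ l → Uniq (c ∷ l)) (sym eP) uP) (subst (λ l → Uniq (c ∷ l)) (sym eQ) uQ)
      (λ v m₁ m₂ → dj v (subst (v ∈ₗ_) eP m₁) (subst (v ∈ₗ_) eQ m₂))

  module EdgeInclusion {n : ℕ} {E E′ : Fin n → Fin n → Bool} {w w′ : Weighting ℝ n}
    (E⊆E′ : ∀ u v → T (E u v) → T (E′ u v)) (w′≡w : ∀ u v → T (E u v) → w′ u v ≡ w u v) where

    mapPath : ∀ {a b} → Path E a b → Path E′ a b
    mapPath here               = here
    mapPath (step {u} {v} e P) = step (E⊆E′ u v e) (mapPath P)

    mapPath-tail : ∀ {a b} (P : Path E a b) → tailVertices (mapPath P) ≡ tailVertices P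
    mapPath-tail here       = refl
    mapPath-tail (step e P) = cong (_ ∷_) (mapPath-tail P)

    mapPath-length : ∀ {a b} (P : Path E a b) → pathLength w′ (mapPath P) ≡ pathLength w P
    mapPath-length here               = refl
    mapPath-length (step {u} {v} e P) = cong₂ _+_ (w′≡w u v e) (mapPath-length P)

    mapArms : ∀ {a b} → LengthPreserving E w E′ w′ a b
    mapArms A@(arms c P Q _ _ _) =
      reArm A (mapPath-tail P) (mapPath-tail Q) , cong₂ _+_ (mapPath-length P) (mapPath-length Q)

  module DeleteEdge {n : ℕ} (E : Fin n → Fin n → Bool) (w : Weighting ℝ n) (x y : Fin n) where

    avoidPath : ∀ {a b} (P : Path E a b) → y ∉ₗ tailVertices P → Path (removeEdge E x y) a b
    avoidPath here               _  = here
    avoidPath (step {u} {v} e P) y∉ =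
      step (T-∧⁺ e (T-not⁺ λ p → y∉ (here (sym (proj₂ (==-pair {a = u} p))))))
           (avoidPath P (λ m → y∉ (there m)))

    avoidPath-tail : ∀ {a b} (P : Path E a b) y∉ → tailVertices (avoidPath P y∉) ≡ tailVertices P
    avoidPath-tail here       _  = refl
    avoidPath-tail (step e P) y∉ = cong (_ ∷_) (avoidPath-tail P (λ m → y∉ (there m)))

    avoidPath-length : ∀ {a b} (P : Path E a b) y∉ → pathLength w (avoidPath P y∉) ≡ pathLength w P
    avoidPath-length here               _  = refl
    avoidPath-length (step {u} {v} e P) y∉ = cong (w u v +_) (avoidPath-length P (λ m → y∉ (there m)))

    avoidArms : ∀ {a b} (A : Arms E a b) → y ∉ₗ tailVertices (Arms.left A) → y ∉ₗ tailVertices (Arms.right A) →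
                Σ (Arms (removeEdge E x y) a b) λ A′ → armsLength w A′ ≡ armsLength w A
    avoidArms A@(arms c P Q _ _ _) y∉P y∉Q =
      reArm A (avoidPath-tail P y∉P) (avoidPath-tail Q y∉Q) ,
      cong₂ _+_ (avoidPath-length P y∉P) (avoidPath-length Q y∉Q)

    open EdgeInclusion {E = removeEdge E x y} {E′ = E} {w} {w} (λ u v e → proj₁ (T-∧⁻ e)) (λ _ _ _ → refl)
      public using () renaming (mapArms to restoreArms)

  module SuppressVertex {n : ℕ} (E : Fin n → Fin n → Bool) (w : Weighting ℝ n) (z a b : Fin n)
    (in-z : ∀ u → T (E u z) → u ≡ a) (out-z : ∀ v → T (E z v) → v ≡ b)
    (e-az : T (E a z)) (e-zb : T (E z b)) (¬e-ab : ¬ T (E a b))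
    (a≢z : a ≢ z) (b≢z : b ≢ z) (a≢b : a ≢ b) where

    E′ : Fin n → Fin n → Bool
    E′ u v = (E u v ∧ not ((u == z) ∨ (v == z))) ∨ ((u == a) ∧ (v == b))

    w′ : Weighting ℝ n
    w′ u v = if (u == a) ∧ (v == b) then w a z + w z b else w u v

    w′-ab : w′ a b ≡ w a z + w z b
    w′-ab = if-true (==-pair-refl a b)

    w′-old : ∀ {u v} → T (E u v) → w′ u v ≡ w u v
    w′-old {u} {v} e = if-false {c = (u == a) ∧ (v == b)} λ p →
      case ==-pair {a = u} {v} {a} {b} p of λ { (refl , refl) → ¬e-ab e }

    E′-old : ∀ {u v} → T (E u v) → u ≢ z → v ≢ z → T (E′ u v)
    E′-old e u≢z v≢z = T-∨⁺ˡ (T-∧⁺ e (T-not⁺ λ p → [ ≢⇒¬== u≢z , ≢⇒¬== v≢z ]′ (T-∨⁻ p)))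

    E′-ab : T (E′ a b)
    E′-ab = T-∨⁺ʳ (==-pair-refl a b)

    E′-cases : ∀ {u v} → T (E′ u v) → (T (E u v) × u ≢ z × v ≢ z) ⊎ (u ≡ a × v ≡ b)
    E′-cases {u} {v} p with T-∨⁻ {E u v ∧ not ((u == z) ∨ (v == z))} p
    ... | inj₁ q = let (e , not-z) = T-∧⁻ q in
                   inj₁ (e , (λ u≡z → T-not⁻ not-z (T-∨⁺ˡ (≡⇒== u≡z))) ,
                             (λ v≡z → T-not⁻ not-z (T-∨⁺ʳ {u == z} (≡⇒== v≡z))))
    ... | inj₂ q = inj₂ (==-pair q)

    b∈path-from-z : ∀ {x} (P : Path E z x) → x ≢ z → b ∈ₗ tailVertices P
    b∈path-from-z here               x≢z = ⊥-elim (x≢z refl)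
    b∈path-from-z (step {w = v} e P) _   = here (sym (out-z v e))

    forthPath : ∀ {c x} (P : Path E c x) → c ≢ z → x ≢ z →
                Σ (Path E′ c x) λ P′ → (pathLength w′ P′ ≡ pathLength w P) ×
                  (∀ v → v ∈ₗ tailVertices P′ → v ∈ₗ tailVertices P) ×
                  (Uniq (vertices P) → Uniq (vertices P′))
    forthPath here _ _ = here , refl , (λ v ()) , λ u → u
    forthPath {c} (step {w = v} e P) c≢z x≢z with v ≟ z
    ... | no v≢z with forthPath P v≢z x≢z
    ...   | P′ , len , sub , uniq = step (E′-old e c≢z v≢z) P′ , cong₂ _+_ (w′-old e) len , sub′ , uniq′
      where
      sub′ : ∀ y → y ∈ₗ v ∷ tailVertices P′ → y ∈ₗ v ∷ tailVertices P
      sub′ y (here p)  = here p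
      sub′ y (there q) = there (sub y q)
      uniq′ : Uniq (c ∷ v ∷ tailVertices P) → Uniq (c ∷ v ∷ tailVertices P′)
      uniq′ (c∉ , u) = (λ { (here p) → c∉ (here p) ; (there q) → c∉ (there (sub c q)) }) , uniq u
    forthPath {c} (step e here) c≢z x≢z | yes refl = ⊥-elim (x≢z refl)
    forthPath {c} (step e (step {w = v} f P)) c≢z x≢z | yes refl with in-z c e | out-z v f
    ... | refl | refl with forthPath P b≢z x≢z
    ... | P′ , len , sub , uniq = step E′-ab P′ , len′ , sub′ , uniq′
      where
      len′ : w′ a b + pathLength w′ P′ ≡ w a z + (w z b + pathLength w P)
      len′ = trans (cong₂ _+_ w′-ab len) (+-assoc _ _ _)
      sub′ : ∀ y → y ∈ₗ b ∷ tailVertices P′ → y ∈ₗ z ∷ b ∷ tailVertices P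
      sub′ y (here p)  = there (here p)
      sub′ y (there q) = there (there (sub y q))
      uniq′ : Uniq (a ∷ z ∷ b ∷ tailVertices P) → Uniq (a ∷ b ∷ tailVertices P′)
      uniq′ (a∉ , _ , u) =
        (λ { (here p) → a∉ (there (here p)) ; (there q) → a∉ (there (there (sub a q))) }) , uniq u

    forthArms : ∀ {p q} (A : Arms E p q) → p ≢ z → q ≢ z →
                Σ (Arms E′ p q) λ A′ → armsLength w′ A′ ≡ armsLength w A
    forthArms (arms c P Q uP uQ dj) p≢z q≢z with c ≟ z
    ... | yes refl = ⊥-elim (dj b (b∈path-from-z P p≢z) (b∈path-from-z Q q≢z))
    ... | no c≢z with forthPath P c≢z p≢z | forthPath Q c≢z q≢z
    ... | P′ , lenP , subP , uniqP | Q′ , lenQ , subQ , uniqQ =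
      arms c P′ Q′ (uniqP uP) (uniqQ uQ) (λ v m₁ m₂ → dj v (subP v m₁) (subQ v m₂)) ,
      cong₂ _+_ lenP lenQ

    avoids-z : ∀ {c x} (P′ : Path E′ c x) → x ≢ z → ∀ v → v ∈ₗ vertices P′ → v ≢ z
    avoids-z here        x≢z v (here refl) = x≢z
    avoids-z (step e P′) x≢z v (here refl) with E′-cases e
    ... | inj₁ (_ , c≢z , _) = c≢z
    ... | inj₂ (refl , _)   = a≢z
    avoids-z (step e P′) x≢z v (there m) = avoids-z P′ x≢z v m

    backPath : ∀ {c x} (P′ : Path E′ c x) → x ≢ z →
               Σ (Path E c x) λ P → (pathLength w P ≡ pathLength w′ P′) ×
                 (∀ v → v ∈ₗ tailVertices P → v ∈ₗ tailVertices P′ ⊎ (v ≡ z × b ∈ₗ tailVertices P′)) ×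
                 (Uniq (vertices P′) → Uniq (vertices P))
    backPath here _ = here , refl , (λ v ()) , λ u → u
    backPath {c} (step {w = v} e P′) x≢z with E′-cases e
    ... | inj₁ (e₀ , c≢z , v≢z) with backPath P′ x≢z
    ...   | P , len , sub , uniq = step e₀ P , cong₂ _+_ (sym (w′-old e₀)) len , sub′ , uniq′
      where
      sub′ : ∀ y → y ∈ₗ v ∷ tailVertices P →
             y ∈ₗ v ∷ tailVertices P′ ⊎ (y ≡ z × b ∈ₗ v ∷ tailVertices P′)
      sub′ y (here p)  = inj₁ (here p)
      sub′ y (there q) with sub y q
      ... | inj₁ r        = inj₁ (there r)
      ... | inj₂ (eq , r) = inj₂ (eq , there r)
      uniq′ : Uniq (c ∷ v ∷ tailVertices P′) → Uniq (c ∷ v ∷ tailVertices P)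
      uniq′ (c∉ , u) = c∉′ , uniq u
        where
        c∉′ : c ∉ₗ v ∷ tailVertices P
        c∉′ (here p)  = c∉ (here p)
        c∉′ (there q) with sub c q
        ... | inj₁ r       = c∉ (there r)
        ... | inj₂ (eq , _) = c≢z eq
    backPath {c} (step {w = v} e P′) x≢z | inj₂ (refl , refl) with backPath P′ x≢z
    ... | P , len , sub , uniq = step e-az (step e-zb P) , len′ , sub′ , uniq′
      where
      len′ : w a z + (w z b + pathLength w P) ≡ w′ a b + pathLength w′ P′
      len′ = trans (sym (+-assoc _ _ _)) (cong₂ _+_ (sym w′-ab) len)
      sub′ : ∀ y → y ∈ₗ z ∷ b ∷ tailVertices P →
             y ∈ₗ b ∷ tailVertices P′ ⊎ (y ≡ z × b ∈ₗ b ∷ tailVertices P′)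
      sub′ y (here p)          = inj₂ (p , here refl)
      sub′ y (there (here p))  = inj₁ (here p)
      sub′ y (there (there q)) with sub y q
      ... | inj₁ r        = inj₁ (there r)
      ... | inj₂ (eq , r) = inj₂ (eq , there r)
      uniq′ : Uniq (a ∷ b ∷ tailVertices P′) → Uniq (a ∷ z ∷ b ∷ tailVertices P)
      uniq′ (a∉ , b∉ , u) = a∉′ , z∉ , uniq (b∉ , u)
        where
        a∉′ : a ∉ₗ z ∷ b ∷ tailVertices P
        a∉′ (here p)          = a≢z p
        a∉′ (there (here p))  = a≢b p
        a∉′ (there (there q)) with sub a q
        ... | inj₁ r        = a∉ (there r)
        ... | inj₂ (eq , _) = a≢z eq
        z∉ : z ∉ₗ b ∷ tailVertices P
        z∉ (here p)  = b≢z (sym p)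
        z∉ (there q) with sub z q
        ... | inj₁ r       = avoids-z P′ x≢z z (there r) refl
        ... | inj₂ (_ , r) = b∉ r

    backArms : ∀ {p q} (A : Arms E′ p q) → p ≢ z → q ≢ z →
               Σ (Arms E p q) λ A′ → armsLength w A′ ≡ armsLength w′ A
    backArms (arms c P′ Q′ uP uQ dj) p≢z q≢z with backPath P′ p≢z | backPath Q′ q≢z
    ... | P , lenP , subP , uniqP | Q , lenQ , subQ , uniqQ =
      arms c P Q (uniqP uP) (uniqQ uQ) dj′ , cong₂ _+_ lenP lenQ
      where
      dj′ : ∀ v → v ∈ₗ tailVertices P → v ∈ₗ tailVertices Q → ⊥
      dj′ v m₁ m₂ with subP v m₁ | subQ v m₂
      ... | inj₁ r₁          | inj₁ r₂          = dj v r₁ r₂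
      ... | inj₁ r₁          | inj₂ (refl , _)  = avoids-z P′ p≢z z (there r₁) refl
      ... | inj₂ (refl , _)  | inj₁ r₂          = avoids-z Q′ q≢z z (there r₂) refl
      ... | inj₂ (_ , b₁)    | inj₂ (_ , b₂)    = dj b b₁ b₂

  module SwapLeaf {n : ℕ} (E : Fin n → Fin n → Bool) (w : Weighting ℝ n) (q l₁ l₂ : Fin n)
    (in-l₁ : ∀ u → T (E u l₁) → u ≡ q) (sink-l₁ : ∀ v → ¬ T (E l₁ v)) (sink-l₂ : ∀ v → ¬ T (E l₂ v))
    (e-ql₂ : T (E q l₂)) where

    swapRight : ∀ {a} (A : Arms E a l₁) → a ≢ l₁ → a ≢ l₂ →
                Σ (Arms E a l₂) λ A′ → armsLength w A′ + w q l₁ ≡ armsLength w A + w q l₂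
    swapRight (arms c P Q uP uQ dj) a≢l₁ a≢l₂ with snocView Q
    swapRight (arms c here       .here uP uQ dj) a≢l₁ a≢l₂ | [] = ⊥-elim (a≢l₁ refl)
    swapRight (arms c (step e P) .here uP uQ dj) a≢l₁ a≢l₂ | [] = ⊥-elim (sink-l₁ _ e)
    swapRight (arms c P .(Q₀ ▷ e) uP uQ dj) a≢l₁ a≢l₂ | Q₀ ∷ʳ e with in-l₁ _ e
    ... | refl = arms c P (Q₀ ▷ e-ql₂) uP uQ′ dj′ , len
      where
      uQ₀ : Uniq (vertices Q₀ ++ l₁ ∷ [])
      uQ₀ = subst (λ l → Uniq (c ∷ l)) (tailVertices-▷ Q₀ e) uQ
      uQ′ : Uniq (vertices (Q₀ ▷ e-ql₂))
      uQ′ = subst (λ l → Uniq (c ∷ l)) (sym (tailVertices-▷ Q₀ e-ql₂))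
              (Uniq-∷ʳ (vertices Q₀) (Uniq-++ˡ (vertices Q₀) uQ₀)
                (λ m → sink-l₂ l₂ (subst (λ x → T (E x l₂)) (sym (sink-is-end Q₀ sink-l₂ m)) e-ql₂)))
      dj′ : ∀ v → v ∈ₗ tailVertices P → v ∈ₗ tailVertices (Q₀ ▷ e-ql₂) → ⊥
      dj′ v m₁ m₂ with ∈-++⁻ (tailVertices Q₀) (subst (v ∈ₗ_) (tailVertices-▷ Q₀ e-ql₂) m₂)
      ... | inj₁ m           = dj v m₁ (subst (v ∈ₗ_) (sym (tailVertices-▷ Q₀ e)) (∈-++⁺ˡ m))
      ... | inj₂ (here refl) = a≢l₂ (sym (sink-is-end P sink-l₂ (there m₁)))
      len : (pathLength w P + pathLength w (Q₀ ▷ e-ql₂)) + w q l₁ ≡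
            (pathLength w P + pathLength w (Q₀ ▷ e)) + w q l₂
      len = begin
        (pathLength w P + pathLength w (Q₀ ▷ e-ql₂)) + w q l₁
          ≡⟨ cong (λ x → (pathLength w P + x) + w q l₁) (pathLength-▷ w Q₀ e-ql₂) ⟩
        (pathLength w P + (pathLength w Q₀ + w q l₂)) + w q l₁
          ≡⟨ solve 4 (λ p q₀ x y → ((p ⊕ (q₀ ⊕ y)) ⊕ x) ⊜ ((p ⊕ (q₀ ⊕ x)) ⊕ y)) refl
                     (pathLength w P) (pathLength w Q₀) (w q l₁) (w q l₂) ⟩
        (pathLength w P + (pathLength w Q₀ + w q l₁)) + w q l₂
          ≡⟨ cong (λ x → (pathLength w P + x) + w q l₂) (sym (pathLength-▷ w Q₀ e)) ⟩
        (pathLength w P + pathLength w (Q₀ ▷ e)) + w q l₂ ∎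
        where open ≡-Reasoning

  module SiblingLeaves {n : ℕ} (E : Fin n → Fin n → Bool) (w : Weighting ℝ n) (q l₁ l₂ : Fin n)
    (in-l₁ : ∀ u → T (E u l₁) → u ≡ q) (in-l₂ : ∀ u → T (E u l₂) → u ≡ q)
    (sink-l₁ : ∀ v → ¬ T (E l₁ v)) (sink-l₂ : ∀ v → ¬ T (E l₂ v))
    (e-ql₁ : T (E q l₁)) (e-ql₂ : T (E q l₂)) {a : Fin n} (a≢l₁ : a ≢ l₁) (a≢l₂ : a ≢ l₂) where

    private
      module 1→2 = SwapLeaf E w q l₁ l₂ in-l₁ sink-l₁ sink-l₂ e-ql₂
      module 2→1 = SwapLeaf E w q l₂ l₁ in-l₂ sink-l₂ sink-l₁ e-ql₁

    IsMinArms-swap : ∀ {d d′} → d + w q l₂ ≡ d′ + w q l₁ → IsMinArms E w a l₁ d → IsMinArms E w a l₂ d′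
    IsMinArms-swap {d} {d′} shift ((A , ℓA) , lb) =
      (proj₁ S , +-cancelʳ-≡ (w q l₁) (trans (proj₂ S) (trans (cong (_+ w q l₂) ℓA) shift))) , lb′
      where
      S = 1→2.swapRight A a≢l₁ a≢l₂
      lb′ : ∀ B → d′ ≤ armsLength w B
      lb′ B = +-cancelʳ-≤ (w q l₁) (subst₂ _≤_ shift (proj₂ S′) (+-monoˡ-≤ (w q l₂) (lb (proj₁ S′))))
        where S′ = 2→1.swapRight B a≢l₂ a≢l₁

    IsMaxArms-swap : ∀ {d d′} → d + w q l₂ ≡ d′ + w q l₁ → IsMaxArms E w a l₁ d → IsMaxArms E w a l₂ d′
    IsMaxArms-swap {d} {d′} shift ((A , ℓA) , ub) =
      (proj₁ S , +-cancelʳ-≡ (w q l₁) (trans (proj₂ S) (trans (cong (_+ w q l₂) ℓA) shift))) , ub′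
      where
      S = 1→2.swapRight A a≢l₁ a≢l₂
      ub′ : ∀ B → armsLength w B ≤ d′
      ub′ B = +-cancelʳ-≤ (w q l₁) (subst₂ _≤_ (proj₂ S′) shift (+-monoˡ-≤ (w q l₂) (ub (proj₁ S′))))
        where S′ = 2→1.swapRight B a≢l₂ a≢l₁

  sink∈arms : ∀ {n} {E : Fin n → Fin n → Bool} {a b v} (A : Arms E a b) → (∀ u → ¬ T (E v u)) →
              (v ∈ₗ tailVertices (Arms.left A) → v ≡ a) × (v ∈ₗ tailVertices (Arms.right A) → v ≡ b)
  sink∈arms (arms c P Q _ _ _) sink =
    (λ m → sink-is-end P sink (there m)) , (λ m → sink-is-end Q sink (there m))

  module NormalNetwork {n m : ℕ} (X : Fin m → Bool) (N : Net n) (lab : Fin m → Fin n) (r : Fin n)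
    (w : Weighting ℝ n) (phylo : IsPhyloNetworkOn N X lab r) (normal : IsNormal N) (outgroup : IsOutgroup N r)
    (retPair : IsRetPairWeighting ℝ N w) where

    open Net N

    edge⇒∈V : ∀ u v → T (E u v) → (u ∈ V) × (v ∈ V)
    edge⇒∈V = let (p , _) = phylo in p

    indeg-root : indeg N root ≡ 0
    indeg-root = let (_ , _ , p , _) = phylo in p

    acyclic : Acyclic N
    acyclic = let (_ , _ , _ , _ , _ , p , _) = phylo in p

    vertex-kinds : ∀ v → v ∈ V → v ≢ root → IsTreeVertex N v ⊎ IsReticulation N v ⊎ IsLeaf N v
    vertex-kinds = let (_ , _ , _ , _ , _ , _ , p , _) = phylo in p

    lab-injective : ∀ x y → x ∈ X → y ∈ X → lab x ≡ lab y → x ≡ y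
    lab-injective = let (_ , _ , _ , _ , _ , _ , _ , _ , _ , p , _) = phylo in p

    lab≢r : ∀ x → x ∈ X → lab x ≢ r
    lab≢r = let (_ , _ , _ , _ , _ , _ , _ , _ , _ , _ , p , _) = phylo in p

    sinks : ∀ v → v ∈ V → outdeg N v ≡ 0 → (v ≡ r) ⊎ Σ (Fin m) (λ x → x ∈ X × lab x ≡ v)
    sinks = let (_ , _ , _ , _ , _ , _ , _ , _ , _ , _ , _ , p , _) = phylo in p

    outdeg-r : outdeg N r ≡ 0
    outdeg-r = let (_ , _ , _ , _ , _ , _ , _ , _ , _ , _ , _ , _ , p , _) = phylo in p

    indeg-r : indeg N r ≡ 1
    indeg-r = let (_ , _ , _ , _ , _ , _ , _ , _ , _ , _ , _ , _ , _ , p , _) = phylo in p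

    lab-degrees : ∀ x → x ∈ X → (outdeg N (lab x) ≡ 0) × (indeg N (lab x) ≡ 1)
    lab-degrees = let (_ , _ , _ , _ , _ , _ , _ , _ , _ , _ , _ , _ , _ , _ , p) = phylo in p

    tree-child : IsTreeChild N
    tree-child = proj₁ normal

    no-shortcut : ∀ u v → ¬ IsShortcut N u v
    no-shortcut = proj₂ normal

    weight-nonneg : ∀ u v → T (E u v) → 0# ≤ w u v
    weight-nonneg = proj₁ retPair

    reticulation-weights : ∀ u₁ u₂ v → IsReticulation N v → Edge N u₁ v → Edge N u₂ v → w u₁ v ≡ w u₂ v
    reticulation-weights = proj₂ (proj₂ retPair)

    edge⇒≢ : ∀ {u v} → T (E u v) → u ≢ v
    edge⇒≢ {u} e refl = acyclic u u e here

    root-no-parent : ∀ u → ¬ T (E u root)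
    root-no-parent u = count≡0⇒¬ (λ u → E u root) indeg-root

    lab-sink : ∀ {x} → x ∈ X → ∀ v → ¬ T (E (lab x) v)
    lab-sink x∈X v = count≡0⇒¬ (λ v → E _ v) (proj₁ (lab-degrees _ x∈X))

    lab-parent-unique : ∀ {x} → x ∈ X → ∀ {u u′} → T (E u (lab x)) → T (E u′ (lab x)) → u ≡ u′
    lab-parent-unique x∈X = count≡1⇒≡ (λ u → E u _) (proj₂ (lab-degrees _ x∈X))

    r-sink : ∀ v → ¬ T (E r v)
    r-sink v = count≡0⇒¬ (λ v → E r v) outdeg-r

    r-parent : ∀ {u} → T (E u r) → u ≡ root
    r-parent e = count≡1⇒≡ (λ u → E u r) indeg-r e outgroup

    lab-≢ : ∀ {x y} → x ∈ X → y ∈ X → x ≢ y → lab x ≢ lab y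
    lab-≢ x∈X y∈X x≢y e = x≢y (lab-injective _ _ x∈X y∈X e)

    parent≢lab : ∀ {x u v} → x ∈ X → T (E u v) → u ≢ lab x
    parent≢lab x∈X e refl = lab-sink x∈X _ e

    two-children⇒tree-vertex : ∀ {v c₁ c₂ g} → T (E g v) → T (E v c₁) → T (E v c₂) → c₁ ≢ c₂ →
                               IsTreeVertex N v
    two-children⇒tree-vertex {v} {g = g} e-gv e₁ e₂ c₁≢c₂
      with vertex-kinds v (proj₂ (edge⇒∈V g v e-gv)) (λ { refl → root-no-parent g e-gv })
    ... | inj₁ tree-vertex          = tree-vertex
    ... | inj₂ (inj₁ (_ , outdeg₁)) = ⊥-elim (c₁≢c₂ (count≡1⇒≡ (λ x → E v x) outdeg₁ e₁ e₂))
    ... | inj₂ (inj₂ (_ , outdeg₀)) = ⊥-elim (count≡0⇒¬ (λ x → E v x) outdeg₀ e₁)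

    path-to-root : ∀ {c} → Path E c root → c ≡ root
    path-to-root here = refl
    path-to-root (step e Q) with path-to-root Q
    ... | refl = ⊥-elim (root-no-parent _ e)

    arms-from-r : ∀ {b} (A : Arms E r b) → b ≢ r →
                  Σ (Path E root b) λ Q → armsLength w A ≡ w root r + pathLength w Q
    arms-from-r (arms c P Q _ _ _) b≢r with snocView P
    arms-from-r (arms c .here here _ _ _)         b≢r | [] = ⊥-elim (b≢r refl)
    arms-from-r (arms c .here (step e Q) _ _ _)   b≢r | [] = ⊥-elim (r-sink _ e)
    arms-from-r (arms c .(P₀ ▷ e) Q _ _ _)        b≢r | P₀ ∷ʳ e with r-parent e
    ... | refl with path-to-root P₀
    ... | refl with P₀
    ... | here       = Q , cong (_+ pathLength w Q) (trans (pathLength-▷ {E = E} w here e) (+-identityˡ _))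
    ... | step f P₁  = ⊥-elim (acyclic _ _ f P₁)

    arms-via-root : ∀ {b} (Q : Path E root b) → b ≢ r →
                    Σ (Arms E r b) λ A → armsLength w A ≡ w root r + pathLength w Q
    arms-via-root {b} Q b≢r =
      arms root (step outgroup here) Q ((λ { (here e) → edge⇒≢ outgroup e }) , (λ ()) , tt)
           (acyclic⇒Uniq acyclic Q) dj ,
      cong (_+ pathLength w Q) (+-identityʳ _)
      where
      dj : ∀ v → v ∈ₗ r ∷ [] → v ∈ₗ tailVertices Q → ⊥
      dj v (here refl) m = b≢r (sym (sink-is-end Q r-sink (there m)))

    maxDist-r⇒root-path : ∀ {x d} → x ∈ X → IsMaxDist ℝ N w r (lab x) d →
                          Σ (Path E root (lab x)) λ Q → d ≡ w root r + pathLength w Q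
    maxDist-r⇒root-path {x} x∈X max with IsMaxDist⇒IsMaxArms N w max
    ... | (A , ℓA) , _ with arms-from-r A (lab≢r x x∈X)
    ... | Q , len = Q , trans (sym ℓA) len

    maxDist-r-bound : ∀ {x d} → x ∈ X → IsMaxDist ℝ N w r (lab x) d →
                      (Q : Path E root (lab x)) → w root r + pathLength w Q ≤ d
    maxDist-r-bound {x} x∈X max Q with IsMaxDist⇒IsMaxArms N w max
    ... | _ , ub with arms-via-root Q (lab≢r x x∈X)
    ... | A , len = subst₂ _≤_ len refl (ub A)

    reach-sink : ∀ {h} → h ∈ V → Σ (Fin n) λ u → Path E h u × u ∈ V × outdeg N u ≡ 0
    reach-sink h∈V = extend n _ here h∈V ℕ.≤-refl
      where
      -- The fuel runs out only on a path with more than n vertices, which acyclicity rules out.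
      extend : ∀ {h} fuel v (P : Path E h v) → v ∈ V → n <ℕ length (vertices P) +ℕ fuel →
               Σ (Fin n) λ u → Path E h u × u ∈ V × outdeg N u ≡ 0
      extend zero v P v∈V n< =
        ⊥-elim (Uniq⇒length≤ (vertices P) (acyclic⇒Uniq acyclic P) (subst (n <ℕ_) (ℕ.+-identityʳ _) n<))
      extend (suc fuel) v P v∈V n< with outdeg N v ℕ.≟ 0
      ... | yes outdeg₀ = v , P , v∈V , outdeg₀
      ... | no outdeg≢0 with tree-child v v∈V outdeg≢0
      ... | c , e , _ = extend fuel c (P ▷ e) (proj₂ (edge⇒∈V v c e)) n<′
        where
        length-▷ : length (vertices (P ▷ e)) ≡ suc (length (vertices P))
        length-▷ = cong suc (trans (cong length (tailVertices-▷ P e))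
                     (trans (length-++ (tailVertices P)) (ℕ.+-comm (length (tailVertices P)) 1)))
        n<′ : n <ℕ length (vertices (P ▷ e)) +ℕ fuel
        n<′ = subst (n <ℕ_) (trans (ℕ.+-suc _ fuel) (cong (_+ℕ fuel) (sym length-▷))) n<

    module CherryReduction (s t : Fin m) (s∈X : s ∈ X) (t∈X : t ∈ X) (s≢t : s ≢ t) (p g : Fin n)
      (e-p-ls : T (E p (lab s))) (e-p-lt : T (E p (lab t))) (e-gp : T (E g p)) where

      private
        ls lt : Fin n
        ls = lab s
        lt = lab t

        ls≢lt : ls ≢ lt
        ls≢lt = lab-≢ s∈X t∈X s≢t

        p-tree-vertex : IsTreeVertex N p
        p-tree-vertex = two-children⇒tree-vertex e-gp e-p-ls e-p-lt ls≢lt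

        p-parent : ∀ {u} → T (E u p) → u ≡ g
        p-parent e = count≡1⇒≡ (λ u → E u p) (proj₁ p-tree-vertex) e e-gp

        p-child : ∀ {v} → T (E p v) → v ≡ ls ⊎ v ≡ lt
        p-child e = count≡2⇒one-of (λ v → E p v) (proj₂ p-tree-vertex) e-p-ls e-p-lt ls≢lt e

        module Cut = DeleteEdge E w p lt
        E₁ = removeEdge E p lt

        in-p : ∀ u → T (E₁ u p) → u ≡ g
        in-p u e = p-parent (proj₁ (T-∧⁻ e))

        out-p : ∀ v → T (E₁ p v) → v ≡ ls
        out-p v e with p-child (proj₁ (T-∧⁻ e))
        ... | inj₁ v≡ls = v≡ls
        ... | inj₂ refl = ⊥-elim (T-not⁻ (proj₂ (T-∧⁻ e)) (==-pair-refl p lt))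

        e-gp₁ : T (E₁ g p)
        e-gp₁ = T-∧⁺ e-gp (T-not⁺ λ q → edge⇒≢ e-gp (==⇒≡ (proj₁ (T-∧⁻ q))))

        e-p-ls₁ : T (E₁ p ls)
        e-p-ls₁ = T-∧⁺ e-p-ls (T-not⁺ λ q → ls≢lt (==⇒≡ (proj₂ (T-∧⁻ {p == p} q))))

        ¬e-g-ls₁ : ¬ T (E₁ g ls)
        ¬e-g-ls₁ q = edge⇒≢ e-gp (lab-parent-unique s∈X (proj₁ (T-∧⁻ q)) e-p-ls)

        module Sup = SuppressVertex E₁ w p g ls in-p out-p e-gp₁ e-p-ls₁ ¬e-g-ls₁
                       (edge⇒≢ e-gp) (λ e → parent≢lab s∈X e-p-ls (sym e)) (parent≢lab s∈X e-gp)

        reduced = reduceNet ℝ N w p g ls lt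
        E″ = Net.E (proj₁ reduced)
        w″ = proj₂ reduced

        Sup⊆reduced : ∀ u v → T (Sup.E′ u v) → T (E″ u v)
        Sup⊆reduced u v q with Sup.E′-cases q
        ... | inj₂ (refl , refl) = T-∨⁺ʳ {E g ls ∧ _} (==-pair-refl g ls)
        ... | inj₁ (e₁ , u≢p , v≢p) =
          T-∨⁺ˡ (T-∧⁺ e (T-nor₄⁺ (≢⇒¬== u≢p) (≢⇒¬== v≢p) (≢⇒¬== (parent≢lab t∈X e)) (≢⇒¬== v≢lt)))
          where
          e = proj₁ (T-∧⁻ e₁)
          v≢lt : v ≢ lt
          v≢lt v≡lt = u≢p (lab-parent-unique t∈X (subst (λ x → T (E u x)) v≡lt e) e-p-lt)

        reduced⊆Sup : ∀ u v → T (E″ u v) → T (Sup.E′ u v)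
        reduced⊆Sup u v q with T-∨⁻ {E u v ∧ _} q
        ... | inj₂ q₂ with ==-pair {a = u} {v} {g} {ls} q₂
        ...   | refl , refl = Sup.E′-ab
        reduced⊆Sup u v q | inj₁ q₁ with T-nor₄⁻ (proj₂ (T-∧⁻ {E u v} q₁))
        ... | u≠p , v≠p , _ , v≠lt =
          Sup.E′-old (T-∧⁺ (proj₁ (T-∧⁻ q₁)) (T-not⁺ λ q′ → v≠lt (proj₂ (T-∧⁻ {u == p} q′))))
                     (¬==⇒≢ u≠p) (¬==⇒≢ v≠p)

        module ToReduced   = EdgeInclusion {E = Sup.E′} {E″} {Sup.w′} {w″} Sup⊆reduced (λ _ _ _ → refl)
        module FromReduced = EdgeInclusion {E = E″} {Sup.E′} {w″} {Sup.w′} reduced⊆Sup (λ _ _ _ → refl)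

        module _ {a b : Fin n} (a≢lt : a ≢ lt) (b≢lt : b ≢ lt) (a≢p : a ≢ p) (b≢p : b ≢ p) where

          forth : LengthPreserving E w E″ w″ a b
          forth A with Cut.avoidArms A (λ m → a≢lt (sym (proj₁ (sink∈arms A (lab-sink t∈X)) m)))
                                       (λ m → b≢lt (sym (proj₂ (sink∈arms A (lab-sink t∈X)) m)))
          ... | A₁ , ℓ₁ with Sup.forthArms A₁ a≢p b≢p
          ... | A₂ , ℓ₂ with ToReduced.mapArms A₂
          ... | A₃ , ℓ₃ = A₃ , trans ℓ₃ (trans ℓ₂ ℓ₁)

          back : LengthPreserving E″ w″ E w a b
          back A with FromReduced.mapArms A
          ... | A₁ , ℓ₁ with Sup.backArms A₁ a≢p b≢p
          ... | A₂ , ℓ₂ with Cut.restoreArms A₂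
          ... | A₃ , ℓ₃ = A₃ , trans ℓ₃ (trans ℓ₂ ℓ₁)

        lab≢lt : ∀ {x} → x ∈ (X minus t) → lab x ≢ lt
        lab≢lt hx = lab-≢ (proj₁ (∈-minus⁻ X hx)) t∈X (proj₂ (∈-minus⁻ X hx))

        lab≢p : ∀ {x} → x ∈ (X minus t) → lab x ≢ p
        lab≢p hx e = parent≢lab (proj₁ (∈-minus⁻ X hx)) e-p-ls (sym e)

        r≢lt : r ≢ lt
        r≢lt e = lab≢r t t∈X (sym e)

        r≢p : r ≢ p
        r≢p refl = r-sink _ e-p-ls

      reduce-minDist : ∀ {x y d} → x ∈ (X minus t) → y ∈ (X minus t) → IsMinDist ℝ N w (lab x) (lab y) d →
                       IsMinDist ℝ (proj₁ reduced) w″ (lab x) (lab y) d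
      reduce-minDist hx hy =
        IsMinArms⇒IsMinDist (proj₁ reduced) w″
        ∘ IsMinArms-transfer (forth (lab≢lt hx) (lab≢lt hy) (lab≢p hx) (lab≢p hy))
                             (back (lab≢lt hx) (lab≢lt hy) (lab≢p hx) (lab≢p hy))
        ∘ IsMinDist⇒IsMinArms N w

      reduce-maxDist : ∀ {x d} → x ∈ (X minus t) → IsMaxDist ℝ N w r (lab x) d →
                       IsMaxDist ℝ (proj₁ reduced) w″ r (lab x) d
      reduce-maxDist hx =
        IsMaxArms⇒IsMaxDist (proj₁ reduced) w″
        ∘ IsMaxArms-transfer (forth r≢lt (lab≢lt hx) r≢p (lab≢p hx))
                             (back r≢lt (lab≢lt hx) r≢p (lab≢p hx))
        ∘ IsMaxDist⇒IsMaxArms N w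

    module ReticulatedCherryIsolation
      (D : Fin m → Fin m → R) (dmax : Fin m → R)
      (minDist : ∀ x y → x ∈ X → y ∈ X → IsMinDist ℝ N w (lab x) (lab y) (D x y))
      (maxDist : ∀ x → x ∈ X → IsMaxDist ℝ N w r (lab x) (dmax x))
      (s t : Fin m) (s∈X : s ∈ X) (t∈X : t ∈ X) (s≢t : s ≢ t)
      (Q-max : ∀ x y → x ∈ X → y ∈ X → x ≢ y → twoQ ℝ D dmax x y ≤ twoQ ℝ D dmax s t)
      (ps pt gt gt′ h : Fin n) (e-ps-ls : T (E ps (lab s))) (e-pt-lt : T (E pt (lab t)))
      (pt-reticulation : IsReticulation N pt) (e-ps-pt : T (E ps pt)) (e-gt-pt : T (E gt pt)) (gt≢ps : gt ≢ ps)
      (gt-tree-vertex : IsTreeVertex N gt) (e-gt′-gt : T (E gt′ gt)) (e-gt-h : T (E gt h)) (h≢pt : h ≢ pt) where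

      private
        ls lt : Fin n
        ls = lab s
        lt = lab t

        ls≢lt : ls ≢ lt
        ls≢lt = lab-≢ s∈X t∈X s≢t

        pt-parent : ∀ {u} → T (E u pt) → u ≡ ps ⊎ u ≡ gt
        pt-parent e = count≡2⇒one-of (λ u → E u pt) (proj₁ pt-reticulation) e-ps-pt e-gt-pt (gt≢ps ∘ sym) e

        pt-child : ∀ {v} → T (E pt v) → v ≡ lt
        pt-child e = count≡1⇒≡ (λ v → E pt v) (proj₂ pt-reticulation) e e-pt-lt

        lt-parent : ∀ {u} → T (E u lt) → u ≡ pt
        lt-parent e = lab-parent-unique t∈X e e-pt-lt

        ls-parent : ∀ {u} → T (E u ls) → u ≡ ps
        ls-parent e = lab-parent-unique s∈X e e-ps-ls

        gt-parent : ∀ {u} → T (E u gt) → u ≡ gt′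
        gt-parent e = count≡1⇒≡ (λ u → E u gt) (proj₁ gt-tree-vertex) e e-gt′-gt

        gt-child : ∀ {v} → T (E gt v) → v ≡ pt ⊎ v ≡ h
        gt-child e = count≡2⇒one-of (λ v → E gt v) (proj₂ gt-tree-vertex) e-gt-pt e-gt-h (h≢pt ∘ sym) e

        ps≢pt : ps ≢ pt
        ps≢pt = edge⇒≢ e-ps-pt

        gt≢pt : gt ≢ pt
        gt≢pt = edge⇒≢ e-gt-pt

        pt≢lt : pt ≢ lt
        pt≢lt = edge⇒≢ e-pt-lt

        h≢lt : h ≢ lt
        h≢lt refl = gt≢pt (lt-parent e-gt-h)

        h≢ls : h ≢ ls
        h≢ls refl = gt≢ps (ls-parent e-gt-h)

        gt′≢h : gt′ ≢ h
        gt′≢h refl = acyclic gt h e-gt-h (step e-gt′-gt here)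

        module Cut = DeleteEdge E w gt pt
        E₁ = removeEdge E gt pt

        in-pt : ∀ u → T (E₁ u pt) → u ≡ ps
        in-pt u e with pt-parent (proj₁ (T-∧⁻ e))
        ... | inj₁ u≡ps = u≡ps
        ... | inj₂ refl = ⊥-elim (T-not⁻ (proj₂ (T-∧⁻ e)) (==-pair-refl gt pt))

        e-ps-pt₁ : T (E₁ ps pt)
        e-ps-pt₁ = T-∧⁺ e-ps-pt (T-not⁺ λ q → gt≢ps (sym (==⇒≡ (proj₁ (T-∧⁻ q)))))

        e-pt-lt₁ : T (E₁ pt lt)
        e-pt-lt₁ = T-∧⁺ e-pt-lt (T-not⁺ λ q → gt≢pt (sym (==⇒≡ (proj₁ (T-∧⁻ q)))))

        module Sup₁ = SuppressVertex E₁ w pt ps lt in-pt (λ v e → pt-child (proj₁ (T-∧⁻ e))) e-ps-pt₁ e-pt-lt₁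
                        (λ q → ps≢pt (lt-parent (proj₁ (T-∧⁻ q)))) ps≢pt (pt≢lt ∘ sym) (parent≢lab t∈X e-ps-pt)
        E₂ = Sup₁.E′

        in-gt : ∀ u → T (E₂ u gt) → u ≡ gt′
        in-gt u q with Sup₁.E′-cases q
        ... | inj₁ (e₁ , _ , _) = gt-parent (proj₁ (T-∧⁻ e₁))
        ... | inj₂ (_ , gt≡lt)  = ⊥-elim (parent≢lab t∈X e-gt-pt gt≡lt)

        out-gt : ∀ v → T (E₂ gt v) → v ≡ h
        out-gt v q with Sup₁.E′-cases q
        ... | inj₂ (gt≡ps , _) = ⊥-elim (gt≢ps gt≡ps)
        ... | inj₁ (e₁ , _ , v≢pt) with gt-child (proj₁ (T-∧⁻ e₁))
        ...   | inj₁ v≡pt = ⊥-elim (v≢pt v≡pt)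
        ...   | inj₂ v≡h  = v≡h

        gt′≢pt : gt′ ≢ pt
        gt′≢pt refl = parent≢lab t∈X e-gt-pt (pt-child e-gt′-gt)

        e-gt′-gt₁ : T (E₁ gt′ gt)
        e-gt′-gt₁ = T-∧⁺ e-gt′-gt (T-not⁺ λ q → edge⇒≢ e-gt′-gt (==⇒≡ (proj₁ (T-∧⁻ q))))

        e-gt-h₁ : T (E₁ gt h)
        e-gt-h₁ = T-∧⁺ e-gt-h (T-not⁺ λ q → h≢pt (==⇒≡ (proj₂ (T-∧⁻ {gt == gt} q))))

        e-gt′-gt₂ : T (E₂ gt′ gt)
        e-gt′-gt₂ = Sup₁.E′-old e-gt′-gt₁ gt′≢pt gt≢pt

        e-gt-h₂ : T (E₂ gt h)
        e-gt-h₂ = Sup₁.E′-old e-gt-h₁ gt≢pt h≢pt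

        -- An edge gt′ → h would be a shortcut, by the path gt′ → gt → h.
        ¬e-gt′-h₂ : ¬ T (E₂ gt′ h)
        ¬e-gt′-h₂ q with Sup₁.E′-cases q
        ... | inj₂ (_ , h≡lt) = h≢lt h≡lt
        ... | inj₁ (e₁ , _ , _) = no-shortcut gt′ h (proj₁ (T-∧⁻ e₁) , detour)
          where
          detour : Path (removeEdge E gt′ h) gt′ h
          detour = step (T-∧⁺ e-gt′-gt (T-not⁺ λ q′ → edge⇒≢ e-gt-h (proj₂ (==-pair {a = gt′} q′))))
                        (step (T-∧⁺ e-gt-h (T-not⁺ λ q′ → edge⇒≢ e-gt′-gt (sym (proj₁ (==-pair {a = gt} q′)))))
                              here)

        module Sup₂ = SuppressVertex E₂ Sup₁.w′ gt gt′ h in-gt out-gt e-gt′-gt₂ e-gt-h₂ ¬e-gt′-h₂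
                        (edge⇒≢ e-gt′-gt) (edge⇒≢ e-gt-h ∘ sym) gt′≢h

        isolated = isolateNet ℝ N w ps pt gt gt′ h ls lt
        E⁺ = Net.E (proj₁ isolated)
        w⁺ = proj₂ isolated

        Sup₂⊆isolated : ∀ u v → T (Sup₂.E′ u v) → T (E⁺ u v)
        Sup₂⊆isolated u v q with Sup₂.E′-cases q
        ... | inj₂ (refl , refl) =
          T-∨⁺ʳ {E gt′ h ∧ _} (T-∨⁺ʳ {(gt′ == ps) ∧ (h == lt)} (==-pair-refl gt′ h))
        ... | inj₁ (q₂ , u≢gt , v≢gt) with Sup₁.E′-cases q₂
        ...   | inj₂ (refl , refl) = T-∨⁺ʳ {E ps lt ∧ _} (T-∨⁺ˡ (==-pair-refl ps lt))
        ...   | inj₁ (e₁ , u≢pt , v≢pt) =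
          T-∨⁺ˡ (T-∧⁺ (proj₁ (T-∧⁻ {E u v} e₁))
                      (T-nor₄⁺ (≢⇒¬== u≢gt) (≢⇒¬== v≢gt) (≢⇒¬== u≢pt) (≢⇒¬== v≢pt)))

        isolated⊆Sup₂ : ∀ u v → T (E⁺ u v) → T (Sup₂.E′ u v)
        isolated⊆Sup₂ u v q with T-∨⁻ {E u v ∧ _} q
        ... | inj₁ q₁ with T-nor₄⁻ (proj₂ (T-∧⁻ {E u v} q₁))
        ...   | u≠gt , v≠gt , u≠pt , v≠pt =
          Sup₂.E′-old (Sup₁.E′-old (T-∧⁺ (proj₁ (T-∧⁻ q₁)) (T-not⁺ λ q′ → u≠gt (proj₁ (T-∧⁻ q′))))
                                   (¬==⇒≢ u≠pt) (¬==⇒≢ v≠pt))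
                      (¬==⇒≢ u≠gt) (¬==⇒≢ v≠gt)
        isolated⊆Sup₂ u v q | inj₂ q₂ with T-∨⁻ {(u == ps) ∧ (v == lt)} q₂
        ... | inj₁ q₃ with ==-pair {a = u} {v} {ps} {lt} q₃
        ...   | refl , refl = Sup₂.E′-old Sup₁.E′-ab (gt≢ps ∘ sym) (parent≢lab t∈X e-gt-pt ∘ sym)
        isolated⊆Sup₂ u v q | inj₂ q₂ | inj₂ q₃ with ==-pair {a = u} {v} {gt′} {h} q₃
        ...   | refl , refl = Sup₂.E′-ab

        w⁺≡Sup₂ : ∀ u v → w⁺ u v ≡ Sup₂.w′ u v
        w⁺≡Sup₂ u v with T? ((u == gt′) ∧ (v == h))
        ... | no ¬gt′h = trans (cong (if (u == ps) ∧ (v == lt) then w ps pt + w pt lt else_) (if-false ¬gt′h))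
                               (sym (if-false {c = (u == gt′) ∧ (v == h)} ¬gt′h))
        ... | yes gt′h with ==-pair {a = u} {v} {gt′} {h} gt′h
        ...   | refl , refl = begin
          w⁺ gt′ h
            ≡⟨ if-false {c = (gt′ == ps) ∧ (h == lt)} (h≢lt ∘ proj₂ ∘ ==-pair) ⟩
          (if (gt′ == gt′) ∧ (h == h) then w gt′ gt + w gt h else w gt′ h)
                                                   ≡⟨ if-true (==-pair-refl gt′ h) ⟩
          w gt′ gt + w gt h
            ≡⟨ cong₂ _+_ (sym (Sup₁.w′-old e-gt′-gt₁)) (sym (Sup₁.w′-old e-gt-h₁)) ⟩
          Sup₁.w′ gt′ gt + Sup₁.w′ gt h            ≡⟨ sym Sup₂.w′-ab ⟩
          Sup₂.w′ gt′ h                            ∎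
          where open ≡-Reasoning

        module ToIsolated   = EdgeInclusion {E = Sup₂.E′} {E⁺} {Sup₂.w′} {w⁺} Sup₂⊆isolated
                                (λ u v _ → w⁺≡Sup₂ u v)
        module FromIsolated = EdgeInclusion {E = E⁺} {Sup₂.E′} {w⁺} {Sup₂.w′} isolated⊆Sup₂
                                (λ u v _ → sym (w⁺≡Sup₂ u v))

        Away : Fin n → Set
        Away a = a ≢ pt × a ≢ gt

        lab-away : ∀ {x} → x ∈ X → Away (lab x)
        lab-away x∈X = parent≢lab x∈X e-pt-lt ∘ sym , parent≢lab x∈X e-gt-pt ∘ sym

        r-away : Away r
        r-away = (λ { refl → r-sink _ e-pt-lt }) , (λ { refl → r-sink _ e-gt-pt })

        path-from-pt-ends-at-lt : ∀ {b} → Path E pt b → b ≢ pt → b ≡ lt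
        path-from-pt-ends-at-lt P b≢pt with successor P (here refl) (b≢pt ∘ sym)
        ... | c , e , m with pt-child e
        ... | refl = sym (sink-is-end P (lab-sink t∈X) (there m))

        pt∉path : ∀ {a b} (P : Path E a b) → b ≢ lt → b ≢ pt → pt ∉ₗ vertices P
        pt∉path P b≢lt b≢pt m = b≢lt (path-from-pt-ends-at-lt (suffix P m) b≢pt)

        module _ {a b : Fin n} (away-a : Away a) (away-b : Away b) where

          forth : (A : Arms E a b) → pt ∉ₗ tailVertices (Arms.left A) → pt ∉ₗ tailVertices (Arms.right A) →
                  Σ (Arms E⁺ a b) λ A′ → armsLength w⁺ A′ ≡ armsLength w A
          forth A pt∉left pt∉right with Cut.avoidArms A pt∉left pt∉right
          ... | A₁ , ℓ₁ with Sup₁.forthArms A₁ (proj₁ away-a) (proj₁ away-b)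
          ... | A₂ , ℓ₂ with Sup₂.forthArms A₂ (proj₂ away-a) (proj₂ away-b)
          ... | A₃ , ℓ₃ with ToIsolated.mapArms A₃
          ... | A₄ , ℓ₄ = A₄ , trans ℓ₄ (trans ℓ₃ (trans ℓ₂ ℓ₁))

          back : LengthPreserving E⁺ w⁺ E w a b
          back A with FromIsolated.mapArms A
          ... | A₁ , ℓ₁ with Sup₂.backArms A₁ (proj₂ away-a) (proj₂ away-b)
          ... | A₂ , ℓ₂ with Sup₁.backArms A₂ (proj₁ away-a) (proj₁ away-b)
          ... | A₃ , ℓ₃ with Cut.restoreArms A₃
          ... | A₄ , ℓ₄ = A₄ , trans ℓ₄ (trans ℓ₃ (trans ℓ₂ ℓ₁))

          forth-off-lt : a ≢ lt → b ≢ lt → LengthPreserving E w E⁺ w⁺ a b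
          forth-off-lt a≢lt b≢lt A@(arms _ P Q _ _ _) =
            forth A (λ m → pt∉path P a≢lt (proj₁ away-a) (there m))
                    (λ m → pt∉path Q b≢lt (proj₁ away-b) (there m))

        ws wp wt wr : R
        ws = w ps ls
        wp = w ps pt
        wt = w pt lt
        wr = w root r

        length-nonneg : ∀ {a b} (P : Path E a b) → 0# ≤ pathLength w P
        length-nonneg = pathLength-nonneg w weight-nonneg

        direct-arms : Arms E ls lt
        direct-arms = arms ps (step e-ps-ls here) (step e-ps-pt (step e-pt-lt here))
          ((λ { (here e) → parent≢lab s∈X e-ps-ls e }) , (λ ()) , tt)
          ((λ { (here e) → ps≢pt e ; (there (here e)) → parent≢lab t∈X e-ps-pt e }) ,
           (λ { (here e) → pt≢lt e }) , (λ ()) , tt)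
          (λ { v (here refl) (here e) → parent≢lab s∈X e-pt-lt (sym e)
             ; v (here refl) (there (here e)) → ls≢lt e })

        direct-arms-length : armsLength w direct-arms ≡ ws + (wp + wt)
        direct-arms-length = cong₂ _+_ (+-identityʳ ws) (cong (wp +_) (+-identityʳ wt))

        -- Both reticulation edges into pt weigh wp, so every up-down path ls ⇝ lt costs at least
        -- ws + wp + wt.
        arms-ls-lt-bound : (A : Arms E ls lt) → ws + (wp + wt) ≤ armsLength w A
        arms-ls-lt-bound (arms c P Q _ _ _) with snocView P | snocView Q
        ... | []       | _  = ⊥-elim (lab-sink s∈X _ (proj₂ (source-has-edge Q ls≢lt)))
        ... | P₀ ∷ʳ e  | [] = ⊥-elim (lab-sink t∈X _ (proj₂ (source-has-edge (P₀ ▷ e) (ls≢lt ∘ sym))))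
        ... | P₀ ∷ʳ e  | Q₀ ∷ʳ f with ls-parent e | lt-parent f
        ... | refl | refl with snocView Q₀
        ... | [] = ⊥-elim (ls≢lt (path-from-pt-ends-at-lt (P₀ ▷ e) (parent≢lab s∈X e-pt-lt ∘ sym)))
        ... | _∷ʳ_ {y} Q₁ f′ = begin
          ws + (wp + wt)
            ≤⟨ +-mono-≤ (x≤y+x ws (length-nonneg P₀)) (+-monoˡ-≤ wt (x≤y+x wp (length-nonneg Q₁))) ⟩
          (pathLength w P₀ + ws) + ((pathLength w Q₁ + wp) + wt)
            ≡⟨ cong (λ z → (pathLength w P₀ + ws) + ((pathLength w Q₁ + z) + wt))
                    (reticulation-weights ps y pt pt-reticulation e-ps-pt f′) ⟩
          (pathLength w P₀ + ws) + ((pathLength w Q₁ + w y pt) + wt)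
            ≡⟨ sym (cong₂ _+_ (pathLength-▷ w P₀ e) (pathLength-▷▷ w Q₁ f′ f)) ⟩
          pathLength w (P₀ ▷ e) + pathLength w (Q₁ ▷ f′ ▷ f) ∎
          where open ≤-Reasoning

        minDist-s-t : D s t ≡ ws + (wp + wt)
        minDist-s-t with IsMinDist⇒IsMinArms N w (minDist s t s∈X t∈X)
        ... | (A , ℓA) , lb = ≤-antisym (subst₂ _≤_ refl direct-arms-length (lb direct-arms))
                                        (subst₂ _≤_ refl ℓA (arms-ls-lt-bound A))

        no-path-h-pt : ¬ Path E h pt
        no-path-h-pt H = no-shortcut gt pt (e-gt-pt , step e-gt-h′ (avoiding⇒removeEdge H gt∉H))
          where
          e-gt-h′ : T (removeEdge E gt pt gt h)
          e-gt-h′ = T-∧⁺ e-gt-h (T-not⁺ λ q → h≢pt (==⇒≡ (proj₂ (T-∧⁻ {gt == gt} q))))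
          gt∉H : gt ∉ₗ vertices H
          gt∉H m = acyclic gt h e-gt-h (prefix H m)

        no-path-h-lt : ¬ Path E h lt
        no-path-h-lt H with snocView H
        ... | []       = h≢lt refl
        ... | H₀ ∷ʳ f with lt-parent f
        ... | refl = no-path-h-pt H₀

        no-path-h-r : ¬ Path E h r
        no-path-h-r H with snocView H
        ... | [] = root-no-parent gt′ (subst (λ z → T (E gt′ z)) (r-parent e-gt-h) e-gt′-gt)
        ... | H₀ ∷ʳ f with r-parent f
        ... | refl = root-no-parent gt (subst (λ z → T (E gt z)) (path-to-root H₀) e-gt-h)

        leaf-below-h : Σ (Fin m) λ y → y ∈ X × y ≢ t × Path E h (lab y)
        leaf-below-h with reach-sink (proj₂ (edge⇒∈V gt h e-gt-h))
        ... | u , H , u∈V , outdeg₀ with sinks u u∈V outdeg₀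
        ... | inj₁ refl             = ⊥-elim (no-path-h-r H)
        ... | inj₂ (y , y∈X , refl) = y , y∈X , (λ { refl → no-path-h-lt H }) , H

        root≢lab : ∀ {x} → x ∈ X → root ≢ lab x
        root≢lab x∈X = parent≢lab x∈X outgroup

        root≢pt : root ≢ pt
        root≢pt e = root-no-parent ps (subst (λ z → T (E ps z)) (sym e) e-ps-pt)

        dmax-s-bound : dmax s + (wp + wt) ≤ dmax t + ws
        dmax-s-bound with maxDist-r⇒root-path s∈X (maxDist s s∈X)
        ... | Q , ds≡ with lastEdge Q (root≢lab s∈X)
        ... | Q₀ ∷ʳ e with ls-parent e
        ... | refl = begin
          dmax s + (wp + wt)
            ≡⟨ cong (_+ (wp + wt)) (trans ds≡ (cong (wr +_) (pathLength-▷ w Q₀ e))) ⟩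
          (wr + (pathLength w Q₀ + ws)) + (wp + wt)
            ≡⟨ solve 5 (λ r q s p t → ((r ⊕ (q ⊕ s)) ⊕ (p ⊕ t)) ⊜ ((r ⊕ ((q ⊕ p) ⊕ t)) ⊕ s))
                       refl wr (pathLength w Q₀) ws wp wt ⟩
          (wr + ((pathLength w Q₀ + wp) + wt)) + ws
            ≡⟨ cong (λ z → (wr + z) + ws) (sym (pathLength-▷▷ w Q₀ e-ps-pt e-pt-lt)) ⟩
          (wr + pathLength w (Q₀ ▷ e-ps-pt ▷ e-pt-lt)) + ws
            ≤⟨ +-monoˡ-≤ ws (maxDist-r-bound t∈X (maxDist t t∈X) (Q₀ ▷ e-ps-pt ▷ e-pt-lt)) ⟩
          dmax t + ws ∎
          where open ≤-Reasoning

        -- The only use of the maximality of Q_r(s,t), against Q_r(t,y) for a leaf y below h.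
        via-gt-bound : (Q₁ : Path E root gt) → dmax t ≡ wr + ((pathLength w Q₁ + w gt pt) + wt) →
                       dmax t + ws ≤ dmax s + (wp + wt)
        via-gt-bound Q₁ dt≡ with leaf-below-h
        ... | y , y∈X , y≢t , H = subst₂ _≤_ (sym dt+ws≡) refl (+-cancelˡ-≤ (dmax t + K) chain)
          where
          a K : R
          a = wr + pathLength w Q₁
          K = w gt h + pathLength w H

          wg≡wp : w gt pt ≡ wp
          wg≡wp = reticulation-weights gt ps pt pt-reticulation e-gt-pt e-ps-pt

          dt+ws≡ : dmax t + ws ≡ (a + ws) + (wp + wt)
          dt+ws≡ = begin
            dmax t + ws
              ≡⟨ cong (_+ ws) dt≡ ⟩
            (wr + ((pathLength w Q₁ + w gt pt) + wt)) + ws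
              ≡⟨ solve 5 (λ r q g t s → ((r ⊕ ((q ⊕ g) ⊕ t)) ⊕ s) ⊜ (((r ⊕ q) ⊕ s) ⊕ (g ⊕ t)))
                         refl wr (pathLength w Q₁) (w gt pt) wt ws ⟩
            (a + ws) + (w gt pt + wt)
              ≡⟨ cong (λ z → (a + ws) + (z + wt)) wg≡wp ⟩
            (a + ws) + (wp + wt) ∎
            where open ≡-Reasoning

          dmax-y-bound : a + K ≤ dmax y
          dmax-y-bound = subst₂ _≤_ root-path-length refl
                           (maxDist-r-bound y∈X (maxDist y y∈X) ((Q₁ ▷ e-gt-h) ++ₚ H))
            where
            root-path-length : wr + pathLength w ((Q₁ ▷ e-gt-h) ++ₚ H) ≡ a + K
            root-path-length = begin
              wr + pathLength w ((Q₁ ▷ e-gt-h) ++ₚ H)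
                ≡⟨ cong (wr +_) (trans (pathLength-++ w (Q₁ ▷ e-gt-h) H)
                                       (cong (_+ pathLength w H) (pathLength-▷ w Q₁ e-gt-h))) ⟩
              wr + ((pathLength w Q₁ + w gt h) + pathLength w H)
                ≡⟨ solve 4 (λ r q x y → (r ⊕ ((q ⊕ x) ⊕ y)) ⊜ ((r ⊕ q) ⊕ (x ⊕ y)))
                           refl wr (pathLength w Q₁) (w gt h) (pathLength w H) ⟩
              a + K ∎
              where open ≡-Reasoning

          arms-t-y : Arms E lt (lab y)
          arms-t-y = arms gt (step e-gt-pt (step e-pt-lt here)) (step e-gt-h H)
            ((λ { (here e) → gt≢pt e ; (there (here e)) → parent≢lab t∈X e-gt-pt e }) ,
             (λ { (here e) → pt≢lt e }) , (λ ()) , tt)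
            (acyclic⇒Uniq acyclic (step e-gt-h H))
            (λ { v (here refl) m → no-path-h-pt (prefix H m)
               ; v (there (here refl)) m → no-path-h-lt (prefix H m) })

          D-t-y-bound : D t y ≤ (wp + wt) + K
          D-t-y-bound = subst₂ _≤_ refl (cong (_+ K) (cong₂ _+_ wg≡wp (+-identityʳ wt)))
                          (proj₂ (IsMinDist⇒IsMinArms N w (minDist t y t∈X y∈X)) arms-t-y)

          chain : (dmax t + K) + ((a + ws) + (wp + wt)) ≤ (dmax t + K) + (dmax s + (wp + wt))
          chain = begin
            (dmax t + K) + ((a + ws) + (wp + wt))
              ≡⟨ solve 5 (λ d k a s p → ((d ⊕ k) ⊕ ((a ⊕ s) ⊕ p)) ⊜ ((d ⊕ (a ⊕ k)) ⊕ (s ⊕ p)))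
                         refl (dmax t) K a ws (wp + wt) ⟩
            (dmax t + (a + K)) + (ws + (wp + wt))
              ≡⟨ cong ((dmax t + (a + K)) +_) (sym minDist-s-t) ⟩
            (dmax t + (a + K)) + D s t
              ≤⟨ +-monoˡ-≤ (D s t) (+-monoʳ-≤ (dmax t) dmax-y-bound) ⟩
            (dmax t + dmax y) + D s t
              ≤⟨ x-y≤z-w⇒x+w≤z+y (Q-max t y t∈X y∈X (y≢t ∘ sym)) ⟩
            (dmax s + dmax t) + D t y
              ≤⟨ +-monoʳ-≤ (dmax s + dmax t) D-t-y-bound ⟩
            (dmax s + dmax t) + ((wp + wt) + K)
              ≡⟨ solve 4 (λ s t p k → ((s ⊕ t) ⊕ (p ⊕ k)) ⊜ ((t ⊕ k) ⊕ (s ⊕ p)))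
                         refl (dmax s) (dmax t) (wp + wt) K ⟩
            (dmax t + K) + (dmax s + (wp + wt)) ∎
            where open ≤-Reasoning

        dmax-t-bound : dmax t + ws ≤ dmax s + (wp + wt)
        dmax-t-bound with maxDist-r⇒root-path t∈X (maxDist t t∈X)
        ... | Q , dt≡ with lastEdge Q (root≢lab t∈X)
        ... | Q₀ ∷ʳ e with lt-parent e
        ... | refl with lastEdge Q₀ root≢pt
        ... | Q₁ ∷ʳ e′ with pt-parent e′
        ... | inj₂ refl = via-gt-bound Q₁ (trans dt≡ (cong (wr +_) (pathLength-▷▷ w Q₁ e′ e)))
        ... | inj₁ refl = begin
          dmax t + ws
            ≡⟨ cong (_+ ws) (trans dt≡ (cong (wr +_) (pathLength-▷▷ w Q₁ e′ e))) ⟩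
          (wr + ((pathLength w Q₁ + wp) + wt)) + ws
            ≡⟨ solve 5 (λ r q s p t → ((r ⊕ ((q ⊕ p) ⊕ t)) ⊕ s) ⊜ ((r ⊕ (q ⊕ s)) ⊕ (p ⊕ t)))
                       refl wr (pathLength w Q₁) ws wp wt ⟩
          (wr + (pathLength w Q₁ + ws)) + (wp + wt)
            ≡⟨ cong (λ z → (wr + z) + (wp + wt)) (sym (pathLength-▷ w Q₁ e-ps-ls)) ⟩
          (wr + pathLength w (Q₁ ▷ e-ps-ls)) + (wp + wt)
            ≤⟨ +-monoˡ-≤ (wp + wt) (maxDist-r-bound s∈X (maxDist s s∈X) (Q₁ ▷ e-ps-ls)) ⟩
          dmax s + (wp + wt) ∎
          where open ≤-Reasoning

        dmax-shift : dmax t + ws ≡ dmax s + (wp + wt)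
        dmax-shift = ≤-antisym dmax-t-bound dmax-s-bound

        γ : R
        γ = dmax t - dmax s

        γ-shift : ∀ d → (d + γ) + ws ≡ d + (wp + wt)
        γ-shift d = begin
          (d + (dmax t - dmax s)) + ws
            ≡⟨ solve 4 (λ d t -s x → ((d ⊕ (t ⊕ -s)) ⊕ x) ⊜ (d ⊕ ((t ⊕ x) ⊕ -s)))
                       refl d (dmax t) (- dmax s) ws ⟩
          d + ((dmax t + ws) - dmax s)
            ≡⟨ cong (λ z → d + (z - dmax s)) (trans dmax-shift (+-comm (dmax s) (wp + wt))) ⟩
          d + (((wp + wt) + dmax s) - dmax s)
            ≡⟨ cong (d +_) (x+y-y≡x (wp + wt) (dmax s)) ⟩
          d + (wp + wt) ∎
          where open ≡-Reasoning

        E⁺-cases : ∀ {u v} → T (E⁺ u v) → (T (E u v) × u ≢ pt) ⊎ (u ≡ ps × v ≡ lt) ⊎ (u ≡ gt′ × v ≡ h)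
        E⁺-cases {u} {v} q with T-∨⁻ {E u v ∧ _} q
        ... | inj₁ q₁ with T-nor₄⁻ {u == gt} {v == gt} {u == pt} {v == pt} (proj₂ (T-∧⁻ {E u v} q₁))
        ...   | _ , _ , u≠pt , _ = inj₁ (proj₁ (T-∧⁻ q₁) , ¬==⇒≢ u≠pt)
        E⁺-cases {u} {v} q | inj₂ q₂ with T-∨⁻ {(u == ps) ∧ (v == lt)} q₂
        ... | inj₁ q₃ = inj₂ (inj₁ (==-pair q₃))
        ... | inj₂ q₃ = inj₂ (inj₂ (==-pair q₃))

        ls-parent⁺ : ∀ u → T (E⁺ u ls) → u ≡ ps
        ls-parent⁺ u q with E⁺-cases q
        ... | inj₁ (e , _)          = ls-parent e
        ... | inj₂ (inj₁ (_ , eq)) = ⊥-elim (ls≢lt eq)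
        ... | inj₂ (inj₂ (_ , eq)) = ⊥-elim (h≢ls (sym eq))

        lt-parent⁺ : ∀ u → T (E⁺ u lt) → u ≡ ps
        lt-parent⁺ u q with E⁺-cases q
        ... | inj₁ (e , u≢pt)       = ⊥-elim (u≢pt (lt-parent e))
        ... | inj₂ (inj₁ (eq , _)) = eq
        ... | inj₂ (inj₂ (_ , eq)) = ⊥-elim (h≢lt (sym eq))

        lab-sink⁺ : ∀ {x} → x ∈ X → ∀ v → ¬ T (E⁺ (lab x) v)
        lab-sink⁺ x∈X v q with E⁺-cases q
        ... | inj₁ (e , _)          = lab-sink x∈X v e
        ... | inj₂ (inj₁ (eq , _)) = parent≢lab x∈X e-ps-pt (sym eq)
        ... | inj₂ (inj₂ (eq , _)) = parent≢lab x∈X e-gt′-gt (sym eq)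

        e⁺-ps-ls : T (E⁺ ps ls)
        e⁺-ps-ls = T-∨⁺ˡ (T-∧⁺ e-ps-ls (T-nor₄⁺ (≢⇒¬== (gt≢ps ∘ sym)) (≢⇒¬== (parent≢lab s∈X e-gt-pt ∘ sym))
                                                 (≢⇒¬== ps≢pt) (≢⇒¬== (parent≢lab s∈X e-pt-lt ∘ sym))))

        e⁺-ps-lt : T (E⁺ ps lt)
        e⁺-ps-lt = T-∨⁺ʳ {E ps lt ∧ _} (T-∨⁺ˡ (==-pair-refl ps lt))

        w⁺-ps-ls : w⁺ ps ls ≡ ws
        w⁺-ps-ls = trans (if-false {c = (ps == ps) ∧ (ls == lt)} (ls≢lt ∘ proj₂ ∘ ==-pair))
                         (if-false {c = (ps == gt′) ∧ (ls == h)} (h≢ls ∘ sym ∘ proj₂ ∘ ==-pair))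

        w⁺-ps-lt : w⁺ ps lt ≡ wp + wt
        w⁺-ps-lt = if-true (==-pair-refl ps lt)

        module Siblings = SiblingLeaves E⁺ w⁺ ps ls lt ls-parent⁺ lt-parent⁺ (lab-sink⁺ s∈X) (lab-sink⁺ t∈X)
                            e⁺-ps-ls e⁺-ps-lt

        lab≢lt : ∀ {x} → x ∈ X → x ≢ t → lab x ≢ lt
        lab≢lt x∈X x≢t = lab-≢ x∈X t∈X x≢t

        r≢lt : r ≢ lt
        r≢lt = lab≢r t t∈X ∘ sym

        minArms-off-t : ∀ {x y} → x ∈ X → y ∈ X → x ≢ t → y ≢ t → IsMinArms E⁺ w⁺ (lab x) (lab y) (D x y)
        minArms-off-t {x} {y} x∈X y∈X x≢t y≢t =
          IsMinArms-transfer (forth-off-lt (lab-away x∈X) (lab-away y∈X) (lab≢lt x∈X x≢t) (lab≢lt y∈X y≢t))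
                             (back (lab-away x∈X) (lab-away y∈X))
                             (IsMinDist⇒IsMinArms N w (minDist x y x∈X y∈X))

        maxArms-off-t : ∀ {x} → x ∈ X → x ≢ t → IsMaxArms E⁺ w⁺ r (lab x) (dmax x)
        maxArms-off-t {x} x∈X x≢t =
          IsMaxArms-transfer (forth-off-lt r-away (lab-away x∈X) r≢lt (lab≢lt x∈X x≢t))
                             (back r-away (lab-away x∈X))
                             (IsMaxDist⇒IsMaxArms N w (maxDist x x∈X))

        minArms-t-t : IsMinArms E⁺ w⁺ lt lt 0#
        minArms-t-t = (arms lt here here ((λ ()) , tt) ((λ ()) , tt) (λ v ()) , +-identityʳ 0#) , lb
          where
          lb : ∀ B → 0# ≤ armsLength w⁺ B
          lb B = subst₂ _≤_ refl (proj₂ G)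
                   (+-nonneg (length-nonneg (Arms.left A)) (length-nonneg (Arms.right A)))
            where
            G = back (lab-away t∈X) (lab-away t∈X) B
            A = proj₁ G

        minArms-s-t : IsMinArms E⁺ w⁺ ls lt (D s t)
        minArms-s-t = (cherry-arms , trans cherry-length (sym minDist-s-t)) , lb
          where
          cherry-arms : Arms E⁺ ls lt
          cherry-arms = arms ps (step e⁺-ps-ls here) (step e⁺-ps-lt here)
            ((λ { (here e) → parent≢lab s∈X e-ps-ls e }) , (λ ()) , tt)
            ((λ { (here e) → parent≢lab t∈X e-ps-pt e }) , (λ ()) , tt)
            (λ { v (here refl) (here e) → ls≢lt e })
          cherry-length : armsLength w⁺ cherry-arms ≡ ws + (wp + wt)
          cherry-length = cong₂ _+_ (trans (+-identityʳ _) w⁺-ps-ls) (trans (+-identityʳ _) w⁺-ps-lt)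
          lb : ∀ B → D s t ≤ armsLength w⁺ B
          lb B = subst₂ _≤_ refl (proj₂ G) (proj₂ (IsMinDist⇒IsMinArms N w (minDist s t s∈X t∈X)) (proj₁ G))
            where G = back (lab-away s∈X) (lab-away t∈X) B

        minArms-t-y : ∀ {y} → y ∈ X → y ≢ s → y ≢ t → IsMinArms E⁺ w⁺ lt (lab y) (D s y + γ)
        minArms-t-y {y} y∈X y≢s y≢t =
          IsMinArms-sym (Siblings.IsMinArms-swap (lab-≢ y∈X s∈X y≢s) (lab≢lt y∈X y≢t) shift
                           (IsMinArms-sym (minArms-off-t s∈X y∈X s≢t y≢t)))
          where
          shift : D s y + w⁺ ps lt ≡ (D s y + γ) + w⁺ ps ls
          shift = trans (cong (D s y +_) w⁺-ps-lt)
                        (sym (trans (cong ((D s y + γ) +_) w⁺-ps-ls) (γ-shift (D s y))))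

        maxArms-t : IsMaxArms E⁺ w⁺ r lt (dmax t)
        maxArms-t = Siblings.IsMaxArms-swap (lab≢r s s∈X ∘ sym) r≢lt shift (maxArms-off-t s∈X s≢t)
          where
          shift : dmax s + w⁺ ps lt ≡ dmax t + w⁺ ps ls
          shift = trans (cong (dmax s +_) w⁺-ps-lt) (sym (trans (cong (dmax t +_) w⁺-ps-ls) dmax-shift))

        isolatedMinArms : ∀ x y → x ∈ X → y ∈ X →
                          IsMinArms E⁺ w⁺ (lab x) (lab y) (isolateD ℝ D dmax s t x y)
        isolatedMinArms x y x∈X y∈X with x ≟ t | y ≟ t | x ≟ s | y ≟ s
        ... | yes refl | yes refl | _         | _        = minArms-t-t
        ... | yes refl | no y≢t   | _         | yes refl = IsMinArms-sym minArms-s-t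
        ... | yes refl | no y≢t   | yes t≡s   | no y≢s   = ⊥-elim (s≢t (sym t≡s))
        ... | yes refl | no y≢t   | no _      | no y≢s   = minArms-t-y y∈X y≢s y≢t
        ... | no x≢t   | yes refl | yes refl  | _        = minArms-s-t
        ... | no x≢t   | yes refl | no x≢s    | _        = IsMinArms-sym (minArms-t-y x∈X x≢s x≢t)
        ... | no x≢t   | no y≢t   | yes refl  | _        = minArms-off-t x∈X y∈X x≢t y≢t
        ... | no x≢t   | no y≢t   | no _      | _        = minArms-off-t x∈X y∈X x≢t y≢t

        isolatedMaxArms : ∀ x → x ∈ X → IsMaxArms E⁺ w⁺ r (lab x) (dmax x)
        isolatedMaxArms x x∈X with x ≟ t
        ... | yes refl = maxArms-t
        ... | no x≢t   = maxArms-off-t x∈X x≢t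

      isolate-minDist : ∀ x y → x ∈ X → y ∈ X →
                        IsMinDist ℝ (proj₁ isolated) w⁺ (lab x) (lab y) (isolateD ℝ D dmax s t x y)
      isolate-minDist x y x∈X y∈X =
        IsMinArms⇒IsMinDist (proj₁ isolated) w⁺ (isolatedMinArms x y x∈X y∈X)

      isolate-maxDist : ∀ x → x ∈ X → IsMaxDist ℝ (proj₁ isolated) w⁺ r (lab x) (dmax x)
      isolate-maxDist x x∈X = IsMaxArms⇒IsMaxDist (proj₁ isolated) w⁺ (isolatedMaxArms x x∈X)

open import Data.Nat using (_≤_)

lemma6 : (ℝ : RealField) → {n m : ℕ} →
    (X : Fin m → Bool) → 2 ≤ count X →
    (N : Net n) (lab : Fin m → Fin n) (r : Fin n) (w : Weighting ℝ n) →
    IsPhyloNetworkOn N X lab r → IsNormal N → IsOutgroup N r →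
    IsRetPairWeighting ℝ N w →
    (D : Fin m → Fin m → RealField.Carrier ℝ) (dmax : Fin m → RealField.Carrier ℝ) →
    (∀ x y → x ∈ X → y ∈ X → IsMinDist ℝ N w (lab x) (lab y) (D x y)) →
    (∀ x → x ∈ X → IsMaxDist ℝ N w r (lab x) (dmax x)) →
    (s t : Fin m) → s ∈ X → t ∈ X → s ≢ t →
    (∀ x y → x ∈ X → y ∈ X → x ≢ y →
      RealField._≤_ ℝ (twoQ ℝ D dmax x y) (twoQ ℝ D dmax s t)) →
    -- cherry case: reducing t
    (∀ p g → Edge N p (lab s) → Edge N p (lab t) → Edge N g p →
      (∀ x y → x ∈ (X minus t) → y ∈ (X minus t) →
        IsMinDist ℝ (proj₁ (reduceNet ℝ N w p g (lab s) (lab t)))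
                    (proj₂ (reduceNet ℝ N w p g (lab s) (lab t))) (lab x) (lab y) (D x y))
      × (∀ x → x ∈ (X minus t) →
        IsMaxDist ℝ (proj₁ (reduceNet ℝ N w p g (lab s) (lab t)))
                    (proj₂ (reduceNet ℝ N w p g (lab s) (lab t))) r (lab x) (dmax x)))
    ×
    -- reticulated cherry case (t the reticulation leaf): isolating {s,t}
    (∀ ps pt gt gt' h → Edge N ps (lab s) → Edge N pt (lab t) → IsReticulation N pt →
      Edge N ps pt → Edge N gt pt → gt ≢ ps → IsTreeVertex N gt →
      Edge N gt' gt → Edge N gt h → h ≢ pt →
      (∀ x y → x ∈ X → y ∈ X →
        IsMinDist ℝ (proj₁ (isolateNet ℝ N w ps pt gt gt' h (lab s) (lab t)))
                    (proj₂ (isolateNet ℝ N w ps pt gt gt' h (lab s) (lab t)))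
                    (lab x) (lab y) (isolateD ℝ D dmax s t x y))
      × (∀ x → x ∈ X →
        IsMaxDist ℝ (proj₁ (isolateNet ℝ N w ps pt gt gt' h (lab s) (lab t)))
                    (proj₂ (isolateNet ℝ N w ps pt gt gt' h (lab s) (lab t))) r (lab x) (dmax x)))
-- The hypothesis |X| ≥ 2 only ensures that a pair {s,t} exists; here the pair is given.
lemma6 ℝ X _ N lab r w phylo normal outgroup retPair D dmax minDist maxDist s t s∈X t∈X s≢t Q-max =
  (λ p g e-p-ls e-p-lt e-gp →
    (λ x y hx hy → Cherry.reduce-minDist p g e-p-ls e-p-lt e-gp hx hy (minDist x y (∈X hx) (∈X hy))) ,
    (λ x hx → Cherry.reduce-maxDist p g e-p-ls e-p-lt e-gp hx (maxDist x (∈X hx)))) ,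
  (λ ps pt gt gt′ h e₁ e₂ ret e₃ e₄ gt≢ps tree e₅ e₆ h≢pt →
    Isolation.isolate-minDist ps pt gt gt′ h e₁ e₂ ret e₃ e₄ gt≢ps tree e₅ e₆ h≢pt ,
    Isolation.isolate-maxDist ps pt gt gt′ h e₁ e₂ ret e₃ e₄ gt≢ps tree e₅ e₆ h≢pt)
  where
  module Cherry = NormalNetwork.CherryReduction ℝ X N lab r w phylo normal outgroup retPair s t s∈X t∈X s≢t
  module Isolation = NormalNetwork.ReticulatedCherryIsolation ℝ X N lab r w phylo normal outgroup retPair
                       D dmax minDist maxDist s t s∈X t∈X s≢t Q-max
  ∈X : ∀ {x} → x ∈ (X minus t) → x ∈ X
  ∈X = proj₁ ∘ ∈-minus⁻ X
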